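{- Let $F_{\underline{213}}(x,t)=\sum_{n\ge0}\sum_{\pi\in\mathbf S_n(132,\underline{123})}x^nt^{\mathrm{occ}_{213}(\pi)}$. Then $aF_{\underline{213}}^2+bF_{\underline{213}}+1=0$, where $a=x^2t$ and $b=-1+x+x^2-x^2t$.
   Context: $\mathbf S_n(132,\underline{123})$ is the set of $\pi\in\mathbf S_n$ with no subsequence order-isomorphic to $132$ and no three consecutive entries order-isomorphic to $123$. $\mathrm{occ}_{213}(\pi)$ is the number of indices $i$ such that $\pi_i\pi_{i+1}\pi_{i+2}$ is order-isomorphic to $213$. -}

module Defs where

open import Data.Bool using (Bool; true; false; _∧_; _∨_; if_then_else_)
open import Data.Nat using (ℕ; zero; suc; _<ᵇ_; _≡ᵇ_; _∸_)
import Data.Nat as N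
open import Data.List using (List; []; _∷_; length; map; concatMap; upTo; filterᵇ)
open import Data.Bool.ListAction using (all; any)
open import Data.Integer using (ℤ; +_; -_; 0ℤ; 1ℤ)
import Data.Integer as Z

-- Permutations of {0,…,n-1} in one-line notation, as lists of naturals.

allLists : ℕ → ℕ → List (List ℕ)
allLists m zero      = [] ∷ []
allLists m (suc len) = concatMap (λ v → map (v ∷_) (allLists m len)) (upTo m)

isPerm : ℕ → List ℕ → Bool
isPerm n l = (length l ≡ᵇ n) ∧ all (λ v → any (λ w → w ≡ᵇ v) l) (upTo n)

perms : ℕ → List (List ℕ)
perms n = filterᵇ (isPerm n) (allLists n n)

above21 : ℕ → List ℕ → Bool
above21 a []      = false
above21 a (b ∷ r) = ((a <ᵇ b) ∧ any (λ c → (a <ᵇ c) ∧ (c <ᵇ b)) r) ∨ above21 a r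

contains132 : List ℕ → Bool
contains132 []      = false
contains132 (a ∷ r) = above21 a r ∨ contains132 r

containsConsec123 : List ℕ → Bool
containsConsec123 (a ∷ b ∷ c ∷ r) = ((a <ᵇ b) ∧ (b <ᵇ c)) ∨ containsConsec123 (b ∷ c ∷ r)
containsConsec123 _               = false

occ213 : List ℕ → ℕ
occ213 (a ∷ b ∷ c ∷ r) = (if (b <ᵇ a) ∧ (a <ᵇ c) then 1 else 0) N.+ occ213 (b ∷ c ∷ r)
occ213 _               = 0

not : Bool → Bool
not true  = false
not false = true

avoids : List ℕ → Bool
avoids π = not (contains132 π) ∧ not (containsConsec123 π)

coeff : ℕ → ℕ → ℕ
coeff n k = length (filterᵇ (λ π → avoids π ∧ (occ213 π ≡ᵇ k)) (perms n))

-- Formal power series in x, t with integer coefficients: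
-- s n k is the coefficient of x^n t^k.

Series : Set
Series = ℕ → ℕ → ℤ

_⊕_ : Series → Series → Series
(f ⊕ g) n k = f n k Z.+ g n k

sumℤ : List ℤ → ℤ
sumℤ []      = 0ℤ
sumℤ (z ∷ zs) = z Z.+ sumℤ zs

_⊗_ : Series → Series → Series
(f ⊗ g) n k = sumℤ (map (λ i → sumℤ (map (λ j → f i j Z.* g (n ∸ i) (k ∸ j)) (upTo (suc k)))) (upTo (suc n)))

mono : ℤ → ℕ → ℕ → Series
mono c i j n k = if (n ≡ᵇ i) ∧ (k ≡ᵇ j) then c else 0ℤ

zeroS : Series
zeroS n k = 0ℤ

oneS : Series
oneS = mono 1ℤ 0 0

F213 : Series
F213 n k = + coeff n k

aS : Series
aS = mono 1ℤ 2 1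

bS : Series
bS = mono (- 1ℤ) 0 0 ⊕ (mono 1ℤ 1 0 ⊕ (mono 1ℤ 2 0 ⊕ mono (- 1ℤ) 2 1))

module Submission where

-- Decompose π ∈ S_{m+2}(132,1̲2̲3̲) at its maximum M = m+1.  Either π = M β with
-- β ∈ S_{m+1}(132,1̲2̲3̲), or π = S a M β; avoiding 132 puts β below a and S, and
-- avoiding 132 and 1̲2̲3̲ makes a the smallest entry before M.  Hence π = build m i σ β
-- for σ, β in the class of sizes i and m-i, and occ213 π = occ213 σ + [σ ≠ ∅] + occ213 β,
-- the extra 213 being (last σ, a, M); conversely every such build is in the class.
-- For c(n,k) = #{π : occ213 π = k} this gives, with Σ the coefficient of F²,
--   c(m+2,0) = c(m+1,0) + c(m,0),   c(m+2,k+1) + c(m,k) = c(m+1,k+1) + c(m,k+1) + Σ,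
-- i.e. F = 1 + x + x(F-1) + x²F + x²t(F-1)F, which is the quadratic equation.

open import Defs
open import Algebra.Bundles using (CommutativeMonoid)
import Algebra.Properties.CommutativeSemigroup as CommSemigroupProperties
open import Data.Bool using (Bool; true; false; T; _∧_; _∨_; if_then_else_)
open import Data.Bool.Properties using (T-∧; T-∨; ∨-assoc)
open import Data.Bool.ListAction using (any)
open import Data.Nat using (ℕ; zero; suc; _≤_; _<_; z≤n; s≤s; _∸_; _≡ᵇ_)
import Data.Nat.Properties as ℕₚ
open import Data.Nat.ListAction using (sum)
open import Data.Integer using (0ℤ)
open import Data.List
  using (List; []; _∷_; _++_; [_]; map; concatMap; length; filterᵇ; foldr; upTo; applyUpTo; cartesianProduct; initLast; _∷ʳ′_)
import Data.List.Properties as Listₚ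
open import Data.List.Membership.Propositional using (_∈_; _∉_; find; lose)
open import Data.List.Membership.Propositional.Properties
  using ( ∈-++⁺ˡ; ∈-++⁺ʳ; ∈-++⁻; ∈-∃++; ∈-map⁺; ∈-map⁻; ∈-filter⁺; ∈-filter⁻; ∈-concatMap⁺; ∈-concatMap⁻
        ; ∈-upTo⁺; ∈-upTo⁻; ∈-cartesianProduct⁺; ∈-cartesianProduct⁻)
open import Data.List.Relation.Binary.Subset.Propositional using (_⊆_)
open import Data.List.Relation.Binary.Sublist.Propositional
  using ([]; _∷_; _∷ʳ_; ⊆-refl; ⊆-trans; to∈; from∈) renaming (_⊆_ to _⊑_)
open import Data.List.Relation.Binary.Sublist.Propositional.Properties using (∷ˡ⁻; ++⁺ˡ; ++⁺ʳ; ++⁺; []⊆-universal)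
open import Data.List.Relation.Binary.Disjoint.Propositional using (Disjoint)
open import Data.List.Relation.Unary.All using (All; []; _∷_)
import Data.List.Relation.Unary.All as All
open import Data.List.Relation.Unary.All.Properties using (all⁺; all⁻)
import Data.List.Relation.Unary.All.Properties as Allₚ
open import Data.List.Relation.Unary.Any using (here; there)
open import Data.List.Relation.Unary.Any.Properties using (any⁺; any⁻)
open import Data.List.Relation.Unary.AllPairs using ([]; _∷_)
open import Data.List.Relation.Unary.Unique.Propositional using (Unique)
import Data.List.Relation.Unary.Unique.Propositional.Properties as Uniqueₚ
open import Data.Product using (∃; _×_; _,_; proj₁; proj₂; uncurry)
open import Data.Sum using (_⊎_; inj₁; inj₂; [_,_]′)
open import Data.Empty using (⊥; ⊥-elim)
open import Function using (_∘_; _⇔_; mk⇔; Equivalence)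
open import Relation.Nullary using (¬_; T?; yes; no; contradiction)
open import Relation.Binary.Definitions using (tri<; tri≈; tri>)
open import Relation.Binary.PropositionalEquality
  using (_≡_; _≢_; refl; sym; trans; cong; cong₂; subst; subst₂; module ≡-Reasoning)

-- The combinatorial half: the recurrences for the counts c(n,k).
module Enumeration where

  open import Data.Nat using (_+_; _*_; _<ᵇ_)

  private
    variable
      A B : Set

  ∈-delete : ∀ {x z : A} ys zs → z ∈ ys ++ x ∷ zs → z ≢ x → z ∈ ys ++ zs
  ∈-delete []       zs (here refl) z≢x = ⊥-elim (z≢x refl)
  ∈-delete []       zs (there p)   z≢x = p
  ∈-delete (y ∷ ys) zs (here refl) z≢x = here refl
  ∈-delete (y ∷ ys) zs (there p)   z≢x = there (∈-delete ys zs p z≢x)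

  length-middle : ∀ {x : A} ys zs → length (ys ++ x ∷ zs) ≡ suc (length (ys ++ zs))
  length-middle []       zs = refl
  length-middle (y ∷ ys) zs = cong suc (length-middle ys zs)

  All-insert : ∀ {P : A → Set} {x} ys zs → All P (ys ++ zs) → P x → All P (ys ++ x ∷ zs)
  All-insert []       zs pzs      px = px ∷ pzs
  All-insert (y ∷ ys) zs (py ∷ p) px = py ∷ All-insert ys zs p px

  unique-insert : ∀ {x : A} ys zs → Unique (ys ++ zs) → x ∉ ys ++ zs → Unique (ys ++ x ∷ zs)
  unique-insert []       zs u x∉ = All.tabulate (λ z∈ x≡z → x∉ (subst (_∈ zs) (sym x≡z) z∈)) ∷ u
  unique-insert (y ∷ ys) zs (y∉ ∷ u) x∉ =
    All-insert ys zs y∉ (λ y≡x → x∉ (here (sym y≡x))) ∷ unique-insert ys zs u (x∉ ∘ there)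

  private
    delete-⊆ : ∀ {x : A} {xs} ys zs → Unique (x ∷ xs) → x ∷ xs ⊆ ys ++ x ∷ zs → xs ⊆ ys ++ zs
    delete-⊆ ys zs (x∉ ∷ _) sub z∈ = ∈-delete ys zs (sub (there z∈)) (λ z≡x → All.lookup x∉ z∈ (sym z≡x))

  unique-length-≤ : ∀ {xs ys : List A} → Unique xs → xs ⊆ ys → length xs ≤ length ys
  unique-length-≤ {xs = []}     _ _ = z≤n
  unique-length-≤ {xs = x ∷ xs} u@(_ ∷ uxs) sub with ys₁ , ys₂ , refl ← ∈-∃++ (sub (here refl)) =
    subst (suc (length xs) ≤_) (sym (length-middle ys₁ ys₂))
          (s≤s (unique-length-≤ uxs (delete-⊆ ys₁ ys₂ u sub)))

  unique-length-≡ : ∀ {xs ys : List A} → Unique xs → Unique ys → xs ⊆ ys → ys ⊆ xs → length xs ≡ length ys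
  unique-length-≡ ux uy xs⊆ys ys⊆xs = ℕₚ.≤-antisym (unique-length-≤ ux xs⊆ys) (unique-length-≤ uy ys⊆xs)

  unique-saturated : ∀ {xs ys : List A} → Unique xs → xs ⊆ ys → length ys ≤ length xs → Unique ys
  unique-saturated {xs = []}     {[]} _ _ _ = []
  unique-saturated {xs = x ∷ xs} u@(_ ∷ uxs) sub len≤ with ys₁ , ys₂ , refl ← ∈-∃++ (sub (here refl)) =
    unique-insert ys₁ ys₂ (unique-saturated uxs sub′ len≤′) x∉
    where
    sub′ : xs ⊆ ys₁ ++ ys₂
    sub′ = delete-⊆ ys₁ ys₂ u sub
    len≤′ : length (ys₁ ++ ys₂) ≤ length xs
    len≤′ = ℕₚ.≤-pred (subst (_≤ suc (length xs)) (length-middle ys₁ ys₂) len≤)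
    x∉ : x ∉ ys₁ ++ ys₂
    x∉ x∈ = ℕₚ.<-irrefl refl (ℕₚ.≤-trans (unique-length-≤ u λ { (here refl) → x∈ ; (there z∈) → sub′ z∈ }) len≤′)

  unique-concatMap : ∀ (g : A → List B) (h : B → A) xs → Unique xs →
                     (∀ {a} → a ∈ xs → Unique (g a)) →
                     (∀ {a z} → a ∈ xs → z ∈ g a → h z ≡ a) → Unique (concatMap g xs)
  unique-concatMap g h []       _          _  _ = []
  unique-concatMap g h (x ∷ xs) (x∉ ∷ uxs) ug hg =
    Uniqueₚ.++⁺ (ug (here refl)) (unique-concatMap g h xs uxs (ug ∘ there) (hg ∘ there)) disjoint
    where
    disjoint : Disjoint (g x) (concatMap g xs)
    disjoint (z∈gx , z∈rest) with y , y∈xs , z∈gy ← find (∈-concatMap⁻ g z∈rest) =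
      All.lookup x∉ y∈xs (trans (sym (hg (here refl) z∈gx)) (hg (there y∈xs) z∈gy))

  unique-map : ∀ (f : A → B) {xs} → Unique xs → (∀ {x y} → x ∈ xs → y ∈ xs → f x ≡ f y → x ≡ y) → Unique (map f xs)
  unique-map f {[]}     _          _   = []
  unique-map f {x ∷ xs} (x∉ ∷ uxs) inj = All.tabulate fresh ∷ unique-map f uxs (λ p q → inj (there p) (there q))
    where
    fresh : ∀ {z} → z ∈ map f xs → f x ≢ z
    fresh z∈ fx≡z with y , y∈ , refl ← ∈-map⁻ f z∈ = All.lookup x∉ y∈ (inj (here refl) (there y∈) fx≡z)

  unique-middle : ∀ xs {x : A} {ys} → Unique (xs ++ x ∷ ys) → x ∉ xs ++ ys
  unique-middle []       (x∉ ∷ _)   x∈            = All.lookup x∉ x∈ refl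
  unique-middle (y ∷ xs) (y∉ ∷ _)   (here refl)   = All.lookup y∉ (∈-++⁺ʳ xs (here refl)) refl
  unique-middle (y ∷ xs) (_ ∷ u)    (there x∈)    = unique-middle xs u x∈

  unique-suffix : ∀ xs {ys : List A} → Unique (xs ++ ys) → Unique ys
  unique-suffix []       u       = u
  unique-suffix (_ ∷ xs) (_ ∷ u) = unique-suffix xs u

  ++-cancel-length : ∀ (xs xs′ : List A) {ys ys′} → length xs ≡ length xs′ →
                     xs ++ ys ≡ xs′ ++ ys′ → xs ≡ xs′ × ys ≡ ys′
  ++-cancel-length []       []         _   eq = refl , eq
  ++-cancel-length (x ∷ xs) (x′ ∷ xs′) len eq with refl , eq′ ← Listₚ.∷-injective eq
    with refl , eq″ ← ++-cancel-length xs xs′ (ℕₚ.suc-injective len) eq′ = refl , eq″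

  count : (A → Bool) → List A → ℕ
  count p xs = length (filterᵇ p xs)

  fibre : (A → ℕ) → ℕ → List A → ℕ
  fibre f j = count (λ x → f x ≡ᵇ j)

  count-cons : ∀ (p : A → Bool) x xs → count p (x ∷ xs) ≡ (if p x then 1 else 0) + count p xs
  count-cons p x xs with p x
  ... | true  = refl
  ... | false = refl

  count-++ : ∀ (p : A → Bool) xs ys → count p (xs ++ ys) ≡ count p xs + count p ys
  count-++ p xs ys = trans (cong length (Listₚ.filter-++ (T? ∘ p) xs ys)) (Listₚ.length-++ (filterᵇ p xs))

  count-concatMap : ∀ (p : B → Bool) (f : A → List B) xs → count p (concatMap f xs) ≡ sum (map (count p ∘ f) xs)
  count-concatMap p f []       = refl
  count-concatMap p f (x ∷ xs) = trans (count-++ p (f x) (concatMap f xs)) (cong (count p (f x) +_) (count-concatMap p f xs))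

  count-map : ∀ (p : B → Bool) (f : A → B) xs → count p (map f xs) ≡ count (p ∘ f) xs
  count-map p f []       = refl
  count-map p f (x ∷ xs) with p (f x)
  ... | true  = cong suc (count-map p f xs)
  ... | false = count-map p f xs

  count-cong : ∀ (p q : A → Bool) xs → (∀ {x} → x ∈ xs → p x ≡ q x) → count p xs ≡ count q xs
  count-cong p q []       _  = refl
  count-cong p q (x ∷ xs) eq with p x | q x | eq (here refl)
  ... | true  | .true  | refl = cong suc (count-cong p q xs (eq ∘ there))
  ... | false | .false | refl = count-cong p q xs (eq ∘ there)

  count-none : ∀ (p : A → Bool) xs → (∀ {x} → x ∈ xs → ¬ T (p x)) → count p xs ≡ 0
  count-none p xs none = cong length (Listₚ.filter-none (T? ∘ p) (All.tabulate none))

  count-filter : ∀ (p q : A → Bool) xs → count (λ x → p x ∧ q x) xs ≡ count q (filterᵇ p xs)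
  count-filter p q []       = refl
  count-filter p q (x ∷ xs) with p x
  ... | false = count-filter p q xs
  ... | true with q x
  ...   | true  = cong suc (count-filter p q xs)
  ...   | false = count-filter p q xs

  count-same-elements : ∀ (p : A → Bool) {xs ys} → Unique xs → Unique ys → xs ⊆ ys → ys ⊆ xs → count p xs ≡ count p ys
  count-same-elements p ux uy xs⊆ys ys⊆xs =
    unique-length-≡ (Uniqueₚ.filter⁺ (T? ∘ p) ux) (Uniqueₚ.filter⁺ (T? ∘ p) uy) (restrict xs⊆ys) (restrict ys⊆xs)
    where
    restrict : ∀ {xs ys} → xs ⊆ ys → filterᵇ p xs ⊆ filterᵇ p ys
    restrict sub z∈ with z∈xs , pz ← ∈-filter⁻ (T? ∘ p) z∈ = ∈-filter⁺ (T? ∘ p) (sub z∈xs) pz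

  module RangeSum {c ℓ} (M : CommutativeMonoid c ℓ) where

    open CommutativeMonoid M
      using (Carrier; _≈_; _∙_; ε; ∙-cong; identityˡ; identityʳ; commutativeSemigroup)
      renaming (refl to ≈-refl; sym to ≈-sym; trans to ≈-trans)
    open CommSemigroupProperties commutativeSemigroup using (interchange)
    open import Relation.Binary.Reasoning.Setoid (CommutativeMonoid.setoid M)

    ∑ : ℕ → (ℕ → Carrier) → Carrier
    ∑ n f = foldr _∙_ ε (applyUpTo f n)

    ∑-cong : ∀ n (f g : ℕ → Carrier) → (∀ i → i < n → f i ≈ g i) → ∑ n f ≈ ∑ n g
    ∑-cong zero    _ _ _  = ≈-refl
    ∑-cong (suc n) f g eq = ∙-cong (eq 0 (s≤s z≤n)) (∑-cong n (f ∘ suc) (g ∘ suc) (λ i i<n → eq (suc i) (s≤s i<n)))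

    ∑-zero : ∀ n (f : ℕ → Carrier) → (∀ i → i < n → f i ≈ ε) → ∑ n f ≈ ε
    ∑-zero zero    _ _ = ≈-refl
    ∑-zero (suc n) f z = ≈-trans (∙-cong (z 0 (s≤s z≤n)) (∑-zero n (f ∘ suc) (λ i i<n → z (suc i) (s≤s i<n)))) (identityˡ ε)

    ∑-single : ∀ n (f : ℕ → Carrier) p → p < n → (∀ i → i < n → i ≢ p → f i ≈ ε) → ∑ n f ≈ f p
    ∑-single (suc n) f zero _ z =
      ≈-trans (∙-cong ≈-refl (∑-zero n (f ∘ suc) (λ i i<n → z (suc i) (s≤s i<n) λ ()))) (identityʳ (f 0))
    ∑-single (suc n) f (suc p) (s≤s p<n) z = begin
      f 0 ∙ ∑ n (f ∘ suc) ≈⟨ ∙-cong (z 0 (s≤s z≤n) λ ()) ≈-refl ⟩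
      ε ∙ ∑ n (f ∘ suc)   ≈⟨ identityˡ _ ⟩
      ∑ n (f ∘ suc)       ≈⟨ ∑-single n (f ∘ suc) p p<n (λ i i<n i≢p → z (suc i) (s≤s i<n) (i≢p ∘ ℕₚ.suc-injective)) ⟩
      f (suc p)           ∎

    ∑-distrib : ∀ n (f g : ℕ → Carrier) → ∑ n (λ i → f i ∙ g i) ≈ ∑ n f ∙ ∑ n g
    ∑-distrib zero    f g = ≈-sym (identityˡ ε)
    ∑-distrib (suc n) f g = begin
      (f 0 ∙ g 0) ∙ ∑ n (λ i → f (suc i) ∙ g (suc i))  ≈⟨ ∙-cong ≈-refl (∑-distrib n (f ∘ suc) (g ∘ suc)) ⟩
      (f 0 ∙ g 0) ∙ (∑ n (f ∘ suc) ∙ ∑ n (g ∘ suc))    ≈⟨ interchange (f 0) (g 0) _ _ ⟩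
      (f 0 ∙ ∑ n (f ∘ suc)) ∙ (g 0 ∙ ∑ n (g ∘ suc))    ∎

  open RangeSum ℕₚ.+-0-commutativeMonoid public

  ≡ᵇ-cong : ∀ {m n m′ n′} → (m ≡ n → m′ ≡ n′) → (m′ ≡ n′ → m ≡ n) → (m ≡ᵇ n) ≡ (m′ ≡ᵇ n′)
  ≡ᵇ-cong {m} {n} {m′} {n′} to from with m ≡ᵇ n in e | m′ ≡ᵇ n′ in e′
  ... | true  | true  = refl
  ... | false | false = refl
  ... | true  | false = contradiction (ℕₚ.≡⇒≡ᵇ m′ n′ (to (ℕₚ.≡ᵇ⇒≡ m n (subst T (sym e) _)))) (subst T e′)
  ... | false | true  = contradiction (ℕₚ.≡⇒≡ᵇ m n (from (ℕₚ.≡ᵇ⇒≡ m′ n′ (subst T (sym e′) _)))) (subst T e)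

  δ : ℕ → ℕ → ℕ
  δ t j = if t ≡ᵇ j then 1 else 0

  ≡ᵇ-refl : ∀ n → (n ≡ᵇ n) ≡ true
  ≡ᵇ-refl zero    = refl
  ≡ᵇ-refl (suc n) = ≡ᵇ-refl n

  ≡ᵇ-≢ : ∀ m n → m ≢ n → (m ≡ᵇ n) ≡ false
  ≡ᵇ-≢ m n m≢n with m ≡ᵇ n in e
  ... | true  = contradiction (ℕₚ.≡ᵇ⇒≡ m n (subst T (sym e) _)) m≢n
  ... | false = refl

  δ-diag : ∀ t → δ t t ≡ 1
  δ-diag t rewrite ≡ᵇ-refl t = refl

  δ-off : ∀ t j → t ≢ j → δ t j ≡ 0
  δ-off t j t≢j rewrite ≡ᵇ-≢ t j t≢j = refl

  fibre-offset : ∀ (g : A → ℕ) t k ys → count (λ y → (t + g y) ≡ᵇ k) ys ≡ ∑ (suc k) (λ j → δ t j * fibre g (k ∸ j) ys)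
  fibre-offset g t k ys with ℕₚ.≤-<-connex t k
  ... | inj₁ t≤k = begin
    count (λ y → (t + g y) ≡ᵇ k) ys   ≡⟨ count-cong _ _ ys (λ {y} _ → ≡ᵇ-cong (to y) (from y)) ⟩
    fibre g (k ∸ t) ys                ≡⟨ sym (ℕₚ.+-identityʳ _) ⟩
    1 * fibre g (k ∸ t) ys            ≡⟨ cong (_* fibre g (k ∸ t) ys) (sym (δ-diag t)) ⟩
    δ t t * fibre g (k ∸ t) ys        ≡⟨ sym (∑-single (suc k) term t (s≤s t≤k) (λ j _ j≢t → off j (j≢t ∘ sym))) ⟩
    ∑ (suc k) term                    ∎
    where
    open ≡-Reasoning
    term : ℕ → ℕ
    term j = δ t j * fibre g (k ∸ j) ys
    off : ∀ j → t ≢ j → term j ≡ 0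
    off j t≢j = cong (_* fibre g (k ∸ j) ys) (δ-off t j t≢j)
    to : ∀ y → t + g y ≡ k → g y ≡ k ∸ t
    to y e = trans (sym (ℕₚ.m+n∸m≡n t (g y))) (cong (_∸ t) e)
    from : ∀ y → g y ≡ k ∸ t → t + g y ≡ k
    from y e = trans (cong (t +_) e) (ℕₚ.m+[n∸m]≡n t≤k)
  ... | inj₂ k<t = trans
    (count-none _ ys (λ {y} _ h → ℕₚ.<⇒≱ k<t (subst (t ≤_) (ℕₚ.≡ᵇ⇒≡ _ k h) (ℕₚ.m≤m+n t (g y)))))
    (sym (∑-zero (suc k) (λ j → δ t j * fibre g (k ∸ j) ys) λ j j≤k →
            cong (_* fibre g (k ∸ j) ys) (δ-off t j λ { refl → ℕₚ.<⇒≱ k<t (ℕₚ.≤-pred j≤k) })))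

  fibre-pairs : ∀ (f : A → ℕ) (g : B → ℕ) xs ys k →
    count (λ p → (f (proj₁ p) + g (proj₂ p)) ≡ᵇ k) (cartesianProduct xs ys) ≡
    ∑ (suc k) (λ j → fibre f j xs * fibre g (k ∸ j) ys)
  fibre-pairs f g []       ys k = sym (∑-zero (suc k) (λ j → fibre f j [] * fibre g (k ∸ j) ys) (λ _ _ → refl))
  fibre-pairs f g (x ∷ xs) ys k = begin
    count P (map (x ,_) ys ++ cartesianProduct xs ys)
      ≡⟨ count-++ P (map (x ,_) ys) _ ⟩
    count P (map (x ,_) ys) + count P (cartesianProduct xs ys)
      ≡⟨ cong₂ _+_ (trans (count-map P (x ,_) ys) (fibre-offset g (f x) k ys)) (fibre-pairs f g xs ys k) ⟩
    ∑ (suc k) (λ j → δ (f x) j * G j) + ∑ (suc k) (λ j → fibre f j xs * G j)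
      ≡⟨ sym (∑-distrib (suc k) (λ j → δ (f x) j * G j) (λ j → fibre f j xs * G j)) ⟩
    ∑ (suc k) (λ j → δ (f x) j * G j + fibre f j xs * G j)
      ≡⟨ ∑-cong (suc k) _ _ (λ j _ → sym (ℕₚ.*-distribʳ-+ (G j) (δ (f x) j) (fibre f j xs))) ⟩
    ∑ (suc k) (λ j → (δ (f x) j + fibre f j xs) * G j)
      ≡⟨ ∑-cong (suc k) _ _ (λ j _ → cong (_* G j) (sym (count-cons (λ x → f x ≡ᵇ j) x xs))) ⟩
    ∑ (suc k) (λ j → fibre f j (x ∷ xs) * G j) ∎
    where
    open ≡-Reasoning
    P : _ → Bool
    P p = (f (proj₁ p) + g (proj₂ p)) ≡ᵇ k
    G : ℕ → ℕ
    G j = fibre g (k ∸ j) ys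

  ∈-allLists⁻ : ∀ m len {l} → l ∈ allLists m len → length l ≡ len × (∀ {x} → x ∈ l → x < m)
  ∈-allLists⁻ m zero      (here refl) = refl , λ ()
  ∈-allLists⁻ m (suc len) l∈
    with v , v<m , l∈′ ← find (∈-concatMap⁻ (λ v → map (v ∷_) (allLists m len)) {xs = upTo m} l∈)
    with l′ , l′∈ , refl ← ∈-map⁻ (v ∷_) l∈′
    with len≡ , bounded ← ∈-allLists⁻ m len l′∈
    = cong suc len≡ , λ { (here refl) → ∈-upTo⁻ v<m ; (there x∈) → bounded x∈ }

  ∈-allLists⁺ : ∀ m len {l} → length l ≡ len → (∀ {x} → x ∈ l → x < m) → l ∈ allLists m len
  ∈-allLists⁺ m zero      {[]}    _     _       = here refl
  ∈-allLists⁺ m (suc len) {v ∷ l} len≡ bounded =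
    ∈-concatMap⁺ (λ v → map (v ∷_) (allLists m len))
      (lose (∈-upTo⁺ (bounded (here refl))) (∈-map⁺ (v ∷_) (∈-allLists⁺ m len (ℕₚ.suc-injective len≡) (bounded ∘ there))))

  -- allLists has no repetitions: distinct first entries give disjoint blocks.
  unique-allLists : ∀ m len → Unique (allLists m len)
  unique-allLists m zero      = [] ∷ []
  unique-allLists m (suc len) =
    unique-concatMap (λ v → map (v ∷_) (allLists m len)) head (upTo m) (Uniqueₚ.upTo⁺ m)
      (λ _ → Uniqueₚ.map⁺ (λ { refl → refl }) (unique-allLists m len))
      (λ _ z∈ → head-of z∈)
    where
    head : List ℕ → ℕ
    head []      = 0
    head (x ∷ _) = x
    head-of : ∀ {v z} → z ∈ map (v ∷_) (allLists m len) → head z ≡ v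
    head-of z∈ with _ , _ , refl ← ∈-map⁻ _ z∈ = refl

  record IsPermutation (n : ℕ) (l : List ℕ) : Set where
    constructor isPermutation
    field
      length≡ : length l ≡ n
      bounded : ∀ {x} → x ∈ l → x < n
      covers  : ∀ v → v < n → v ∈ l
  open IsPermutation public

  isPerm⇔ : ∀ n l → T (isPerm n l) ⇔ (length l ≡ n × (∀ v → v < n → v ∈ l))
  isPerm⇔ n l = mk⇔
    (λ h → let len , cov = Equivalence.to (T-∧ {length l ≡ᵇ n}) h
           in ℕₚ.≡ᵇ⇒≡ _ n len , λ v v<n → occurs v (All.lookup (all⁺ _ (upTo n) cov) (∈-upTo⁺ v<n)))
    (λ (len , cov) → Equivalence.from T-∧
       (ℕₚ.≡⇒≡ᵇ _ n len , all⁻ _ (All.tabulate λ {v} v∈ →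
          any⁺ _ (lose (cov v (∈-upTo⁻ v∈)) (ℕₚ.≡⇒≡ᵇ v v refl)))))
    where
    occurs : ∀ v → T (any (λ w → w ≡ᵇ v) l) → v ∈ l
    occurs v h with w , w∈ , w≡v ← find (any⁻ _ l h) = subst (_∈ l) (ℕₚ.≡ᵇ⇒≡ w v w≡v) w∈

  ∈-perms⁻ : ∀ n {l} → l ∈ perms n → IsPermutation n l
  ∈-perms⁻ n l∈ with l∈all , isP ← ∈-filter⁻ (T? ∘ isPerm n) {xs = allLists n n} l∈ =
    let len , cov = Equivalence.to (isPerm⇔ n _) isP
    in isPermutation len (proj₂ (∈-allLists⁻ n n l∈all)) cov

  ∈-perms⁺ : ∀ n {l} → IsPermutation n l → l ∈ perms n
  ∈-perms⁺ n (isPermutation len bnd cov) =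
    ∈-filter⁺ (T? ∘ isPerm n) (∈-allLists⁺ n n len bnd) (Equivalence.from (isPerm⇔ n _) (len , cov))

  unique-perms : ∀ n → Unique (perms n)
  unique-perms n = Uniqueₚ.filter⁺ (T? ∘ isPerm n) (unique-allLists n n)

  -- A permutation has no repeated entries: it covers the n values 0, …, n-1 with n entries.
  permutation-unique : ∀ {n l} → IsPermutation n l → Unique l
  permutation-unique {n} (isPermutation len _ cov) =
    unique-saturated (Uniqueₚ.upTo⁺ n) (cov _ ∘ ∈-upTo⁻)
      (subst (_≤ length (upTo n)) (sym len) (ℕₚ.≤-reflexive (sym (Listₚ.length-upTo n))))

  Av : ℕ → List (List ℕ)
  Av n = filterᵇ avoids (perms n)

  unique-Av : ∀ n → Unique (Av n)
  unique-Av n = Uniqueₚ.filter⁺ (T? ∘ avoids) (unique-perms n)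

  <ᵇ⇒< : ∀ {a b} → T (a <ᵇ b) → a < b
  <ᵇ⇒< = ℕₚ.<ᵇ⇒< _ _

  <⇒<ᵇ : ∀ {a b} → a < b → T (a <ᵇ b)
  <⇒<ᵇ = ℕₚ.<⇒<ᵇ

  T-∨ʳ : ∀ a {b} → T b → T (a ∨ b)
  T-∨ʳ true  _ = _
  T-∨ʳ false t = t

  data Occ132 (l : List ℕ) : Set where
    occ132 : ∀ {x y z} → x ∷ y ∷ z ∷ [] ⊑ l → x < z → z < y → Occ132 l

  data Consec123 (l : List ℕ) : Set where
    consec123 : ∀ p {x y z} q → l ≡ p ++ x ∷ y ∷ z ∷ q → x < y → y < z → Consec123 l

  above21-sound : ∀ a r → T (above21 a r) → ∃ λ y → ∃ λ z → y ∷ z ∷ [] ⊑ r × a < z × z < y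
  above21-sound a (b ∷ r) h with Equivalence.to T-∨ h
  ... | inj₂ h′ with y , z , s , a<z , z<y ← above21-sound a r h′ = y , z , b ∷ʳ s , a<z , z<y
  ... | inj₁ h′ with a<b , h″ ← Equivalence.to (T-∧ {a <ᵇ b}) h′
                with c , c∈r , a<c<b ← find (any⁻ _ r h″)
                with a<c , c<b ← Equivalence.to (T-∧ {a <ᵇ c}) a<c<b
    = b , c , refl ∷ from∈ c∈r , <ᵇ⇒< a<c , <ᵇ⇒< c<b

  above21-complete : ∀ a r {y z} → y ∷ z ∷ [] ⊑ r → a < z → z < y → T (above21 a r)
  above21-complete a (b ∷ r) (.b ∷ʳ s) a<z z<y = Equivalence.from T-∨ (inj₂ (above21-complete a r s a<z z<y))
  above21-complete a (b ∷ r) (refl ∷ s) a<z z<y = Equivalence.from T-∨ (inj₁ (Equivalence.from T-∧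
    (<⇒<ᵇ (ℕₚ.<-trans a<z z<y) , any⁺ _ (lose (to∈ s) (Equivalence.from T-∧ (<⇒<ᵇ a<z , <⇒<ᵇ z<y))))))

  contains132-sound : ∀ l → T (contains132 l) → Occ132 l
  contains132-sound (a ∷ r) h with Equivalence.to T-∨ h
  ... | inj₁ h′ with y , z , s , a<z , z<y ← above21-sound a r h′ = occ132 (refl ∷ s) a<z z<y
  ... | inj₂ h′ with occ132 s x<z z<y ← contains132-sound r h′ = occ132 (a ∷ʳ s) x<z z<y

  contains132-complete : ∀ l → Occ132 l → T (contains132 l)
  contains132-complete (a ∷ r) (occ132 (.a ∷ʳ s) x<z z<y) =
    Equivalence.from T-∨ (inj₂ (contains132-complete r (occ132 s x<z z<y)))
  contains132-complete (a ∷ r) (occ132 (refl ∷ s) x<z z<y) =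
    Equivalence.from T-∨ (inj₁ (above21-complete a r s x<z z<y))

  consec123-sound : ∀ l → T (containsConsec123 l) → Consec123 l
  consec123-sound (a ∷ b ∷ c ∷ r) h = [ here′ , there′ ∘ consec123-sound (b ∷ c ∷ r) ]′ (Equivalence.to T-∨ h)
    where
    here′ : T ((a <ᵇ b) ∧ (b <ᵇ c)) → Consec123 (a ∷ b ∷ c ∷ r)
    here′ h′ with a<b , b<c ← Equivalence.to (T-∧ {a <ᵇ b}) h′ = consec123 [] r refl (<ᵇ⇒< a<b) (<ᵇ⇒< b<c)
    there′ : Consec123 (b ∷ c ∷ r) → Consec123 (a ∷ b ∷ c ∷ r)
    there′ (consec123 p q eq x<y y<z) = consec123 (a ∷ p) q (cong (a ∷_) eq) x<y y<z

  consec123-at : ∀ p {x y z} q → x < y → y < z → T (containsConsec123 (p ++ x ∷ y ∷ z ∷ q))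
  consec123-at []                  q x<y y<z = Equivalence.from T-∨ (inj₁ (Equivalence.from T-∧ (<⇒<ᵇ x<y , <⇒<ᵇ y<z)))
  consec123-at (a ∷ [])            {x} q x<y y<z = T-∨ʳ ((a <ᵇ x) ∧ _) (consec123-at [] q x<y y<z)
  consec123-at (a ∷ b ∷ [])        {x} q x<y y<z = T-∨ʳ ((a <ᵇ b) ∧ (b <ᵇ x)) (consec123-at (b ∷ []) q x<y y<z)
  consec123-at (a ∷ p@(b ∷ c ∷ _)) q x<y y<z     = T-∨ʳ ((a <ᵇ b) ∧ (b <ᵇ c)) (consec123-at p q x<y y<z)

  consec123-complete : ∀ {l} → Consec123 l → T (containsConsec123 l)
  consec123-complete (consec123 p q refl x<y y<z) = consec123-at p q x<y y<z

  T-not : ∀ b → T (not b) ⇔ (¬ T b)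
  T-not true  = mk⇔ (λ ()) (λ f → f _)
  T-not false = mk⇔ (λ _ ()) (λ _ → _)

  record Avoids (l : List ℕ) : Set where
    constructor avoiding
    field
      no132 : ¬ Occ132 l
      no123 : ¬ Consec123 l
  open Avoids public

  avoids⇔ : ∀ l → T (avoids l) ⇔ Avoids l
  avoids⇔ l = mk⇔
    (λ h → let n132 , n123 = Equivalence.to (T-∧ {not (contains132 l)}) h
           in avoiding (Equivalence.to (T-not _) n132 ∘ contains132-complete l)
                       (Equivalence.to (T-not _) n123 ∘ consec123-complete))
    (λ (avoiding n132 n123) → Equivalence.from T-∧
       ( Equivalence.from (T-not _) (n132 ∘ contains132-sound l)
       , Equivalence.from (T-not _) (n123 ∘ consec123-sound l)))

  Avoids-subst : ∀ {l l′} → avoids l ≡ avoids l′ → Avoids l → Avoids l′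
  Avoids-subst {l} {l′} eq av = Equivalence.to (avoids⇔ l′) (subst T eq (Equivalence.from (avoids⇔ l) av))

  ∈-Av⁻ : ∀ n {l} → l ∈ Av n → IsPermutation n l × Avoids l
  ∈-Av⁻ n l∈ with l∈perms , av ← ∈-filter⁻ (T? ∘ avoids) {xs = perms n} l∈ =
    ∈-perms⁻ n l∈perms , Equivalence.to (avoids⇔ _) av

  ∈-Av⁺ : ∀ n {l} → IsPermutation n l → Avoids l → l ∈ Av n
  ∈-Av⁺ n isP av = ∈-filter⁺ (T? ∘ avoids) (∈-perms⁺ n isP) (Equivalence.from (avoids⇔ _) av)

  -- Both patterns are inherited by any list containing l as a factor, so
  -- every factor of an avoiding list avoids both patterns.
  avoids-factor : ∀ p l q → Avoids (p ++ l ++ q) → Avoids l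
  avoids-factor p l q (avoiding n132 n123) = avoiding
    (λ { (occ132 s x<z z<y) → n132 (occ132 (⊆-trans s (++⁺ˡ p (++⁺ʳ q ⊆-refl))) x<z z<y) })
    (λ { (consec123 p′ q′ l≡ x<y y<z) → n123 (consec123 (p ++ p′) (q′ ++ q) (shape l≡) x<y y<z) })
    where
    shape : ∀ {p′ q′ x y z} → l ≡ p′ ++ x ∷ y ∷ z ∷ q′ → p ++ l ++ q ≡ (p ++ p′) ++ x ∷ y ∷ z ∷ q′ ++ q
    shape {p′} {q′} {x} {y} {z} refl = begin
      p ++ (p′ ++ x ∷ y ∷ z ∷ q′) ++ q  ≡⟨ cong (p ++_) (Listₚ.++-assoc p′ (x ∷ y ∷ z ∷ q′) q) ⟩
      p ++ p′ ++ x ∷ y ∷ z ∷ q′ ++ q    ≡⟨ sym (Listₚ.++-assoc p p′ _) ⟩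
      (p ++ p′) ++ x ∷ y ∷ z ∷ q′ ++ q  ∎
      where open ≡-Reasoning

  <ᵇ-true : ∀ {a b} → a < b → (a <ᵇ b) ≡ true
  <ᵇ-true {zero}  {suc b} _         = refl
  <ᵇ-true {suc a} {suc b} (s≤s a<b) = <ᵇ-true a<b

  <ᵇ-false : ∀ {a b} → b ≤ a → (a <ᵇ b) ≡ false
  <ᵇ-false {a}     {zero}  _         = refl
  <ᵇ-false {suc a} {suc b} (s≤s b≤a) = <ᵇ-false b≤a

  -- Adding a constant to every entry preserves the relative order of entries,
  -- hence every pattern statistic.
  shift : ℕ → List ℕ → List ℕ
  shift c = map (c +_)

  <ᵇ-shift : ∀ c a b → ((c + a) <ᵇ (c + b)) ≡ (a <ᵇ b)
  <ᵇ-shift zero    a b = refl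
  <ᵇ-shift (suc c) a b = <ᵇ-shift c a b

  above21-shift : ∀ c a r → above21 (c + a) (shift c r) ≡ above21 a r
  above21-shift c a []      = refl
  above21-shift c a (b ∷ r) = cong₂ _∨_ (cong₂ _∧_ (<ᵇ-shift c a b) (between r)) (above21-shift c a r)
    where
    between : ∀ r → any (λ x → ((c + a) <ᵇ x) ∧ (x <ᵇ (c + b))) (shift c r) ≡ any (λ x → (a <ᵇ x) ∧ (x <ᵇ b)) r
    between []      = refl
    between (x ∷ r) = cong₂ _∨_ (cong₂ _∧_ (<ᵇ-shift c a x) (<ᵇ-shift c x b)) (between r)

  avoids-shift : ∀ c σ → avoids (shift c σ) ≡ avoids σ
  avoids-shift c σ = cong₂ (λ u v → not u ∧ not v) (contains132-shift σ) (consec123-shift σ)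
    where
    contains132-shift : ∀ σ → contains132 (shift c σ) ≡ contains132 σ
    contains132-shift []      = refl
    contains132-shift (a ∷ σ) = cong₂ _∨_ (above21-shift c a σ) (contains132-shift σ)
    consec123-shift : ∀ σ → containsConsec123 (shift c σ) ≡ containsConsec123 σ
    consec123-shift []                = refl
    consec123-shift (a ∷ [])          = refl
    consec123-shift (a ∷ b ∷ [])      = refl
    consec123-shift (a ∷ b ∷ d ∷ σ)   =
      cong₂ _∨_ (cong₂ _∧_ (<ᵇ-shift c a b) (<ᵇ-shift c b d)) (consec123-shift (b ∷ d ∷ σ))

  occ213-shift : ∀ c σ → occ213 (shift c σ) ≡ occ213 σ
  occ213-shift c []              = refl
  occ213-shift c (a ∷ [])        = refl
  occ213-shift c (a ∷ b ∷ [])    = refl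
  occ213-shift c (a ∷ b ∷ d ∷ σ) =
    cong₂ _+_ (cong (λ u → if u then 1 else 0) (cong₂ _∧_ (<ᵇ-shift c b a) (<ᵇ-shift c a d))) (occ213-shift c (b ∷ d ∷ σ))

  -- An entry M larger than all later entries starts no occurrence of any of the patterns.
  module PrependMaximum (M : ℕ) where

    consec123-max : ∀ β → All (_< M) β → containsConsec123 (M ∷ β) ≡ containsConsec123 β
    consec123-max []           _          = refl
    consec123-max (b ∷ [])     _          = refl
    consec123-max (b ∷ b′ ∷ β) (b<M ∷ _) rewrite <ᵇ-false (ℕₚ.<⇒≤ b<M) = refl

    above21-max : ∀ β → All (_< M) β → above21 M β ≡ false
    above21-max []      _            = refl
    above21-max (b ∷ β) (b<M ∷ β<M) rewrite <ᵇ-false (ℕₚ.<⇒≤ b<M) = above21-max β β<M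

    avoids-max : ∀ β → All (_< M) β → avoids (M ∷ β) ≡ avoids β
    avoids-max β β<M rewrite above21-max β β<M | consec123-max β β<M = refl

    occ213-max : ∀ β → All (_< M) β → occ213 (M ∷ β) ≡ occ213 β
    occ213-max []           _               = refl
    occ213-max (b ∷ [])     _               = refl
    occ213-max (b ∷ b′ ∷ β) (_ ∷ b′<M ∷ _) rewrite <ᵇ-false (ℕₚ.<⇒≤ b′<M) with b <ᵇ M
    ... | true  = refl
    ... | false = refl

  open PrependMaximum public

  nonEmpty : List ℕ → ℕ
  nonEmpty []      = 0
  nonEmpty (_ ∷ _) = 1

  -- Statistics of xs ++ a M β when a < xs < M and β < M: the only new
  -- consecutive triple that can form a pattern is (last xs, a, M), a 213.
  module Valley (a M : ℕ) (a<M : a < M) where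

    -- The triples (a, M, b₁) and (M, b₁, b₂) are never 213 nor 123.
    occ213-valley₀ : ∀ β → All (_< M) β → occ213 (a ∷ M ∷ β) ≡ occ213 β
    occ213-valley₀ []      _   = refl
    occ213-valley₀ (b ∷ β) β<M rewrite <ᵇ-false (ℕₚ.<⇒≤ a<M) = occ213-max M (b ∷ β) β<M

    occ213-valley : ∀ xs β → All (λ x → a < x × x < M) xs → All (_< M) β →
                    occ213 (xs ++ a ∷ M ∷ β) ≡ occ213 xs + nonEmpty xs + occ213 β
    occ213-valley [] β _ β<M = occ213-valley₀ β β<M
    occ213-valley (x ∷ []) β ((a<x , x<M) ∷ []) β<M rewrite <ᵇ-true a<x | <ᵇ-true x<M =
      cong suc (occ213-valley₀ β β<M)
    occ213-valley (x₁ ∷ x₂ ∷ []) β ((a<x₁ , _) ∷ (a<x₂ , x₂<M) ∷ []) β<M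
      rewrite <ᵇ-false (ℕₚ.<⇒≤ a<x₁) | <ᵇ-true a<x₂ | <ᵇ-true x₂<M with x₂ <ᵇ x₁
    ... | true  = cong suc (occ213-valley₀ β β<M)
    ... | false = cong suc (occ213-valley₀ β β<M)
    occ213-valley (x₁ ∷ xs@(x₂ ∷ x₃ ∷ _)) β (_ ∷ bounds) β<M = begin
      t + occ213 (xs ++ a ∷ M ∷ β)         ≡⟨ cong (t +_) (occ213-valley xs β bounds β<M) ⟩
      t + (occ213 xs + 1 + occ213 β)       ≡⟨ sym (ℕₚ.+-assoc t (occ213 xs + 1) (occ213 β)) ⟩
      t + (occ213 xs + 1) + occ213 β       ≡⟨ cong (_+ occ213 β) (sym (ℕₚ.+-assoc t (occ213 xs) 1)) ⟩
      t + occ213 xs + 1 + occ213 β         ∎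
      where
      open ≡-Reasoning
      t : ℕ
      t = if (x₂ <ᵇ x₁) ∧ (x₁ <ᵇ x₃) then 1 else 0

    consec123-valley₀ : ∀ β → All (_< M) β → containsConsec123 (a ∷ M ∷ β) ≡ containsConsec123 β
    consec123-valley₀ []      _                  = refl
    consec123-valley₀ (b ∷ β) β<M@(b<M ∷ _) rewrite <ᵇ-false (ℕₚ.<⇒≤ b<M) | <ᵇ-true a<M =
      consec123-max M (b ∷ β) β<M

    consec123-valley : ∀ xs β → All (λ x → a < x × x < M) xs → All (_< M) β →
                       containsConsec123 (xs ++ a ∷ M ∷ β) ≡ containsConsec123 xs ∨ containsConsec123 β
    consec123-valley [] β _ β<M = consec123-valley₀ β β<M
    consec123-valley (x ∷ []) β ((a<x , _) ∷ []) β<M rewrite <ᵇ-false (ℕₚ.<⇒≤ a<x) = consec123-valley₀ β β<M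
    consec123-valley (x₁ ∷ x₂ ∷ []) β (_ ∷ (a<x₂ , _) ∷ []) β<M rewrite <ᵇ-false (ℕₚ.<⇒≤ a<x₂) with x₁ <ᵇ x₂
    ... | true  = consec123-valley₀ β β<M
    ... | false = consec123-valley₀ β β<M
    consec123-valley (x₁ ∷ xs@(x₂ ∷ x₃ ∷ _)) β (_ ∷ bounds) β<M =
      trans (cong (((x₁ <ᵇ x₂) ∧ (x₂ <ᵇ x₃)) ∨_) (consec123-valley xs β bounds β<M))
            (sym (∨-assoc ((x₁ <ᵇ x₂) ∧ (x₂ <ᵇ x₃)) _ _))

  open Valley public

  ⊑-split : ∀ S {t T : List ℕ} → t ⊑ S ++ T → ∃ λ t₁ → ∃ λ t₂ → t ≡ t₁ ++ t₂ × t₁ ⊑ S × t₂ ⊑ T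
  ⊑-split []      s = [] , _ , refl , [] , s
  ⊑-split (x ∷ S) (.x ∷ʳ s) with t₁ , t₂ , refl , s₁ , s₂ ← ⊑-split S s = t₁ , t₂ , refl , x ∷ʳ s₁ , s₂
  ⊑-split (x ∷ S) (refl ∷ s) with t₁ , t₂ , refl , s₁ , s₂ ← ⊑-split S s = x ∷ t₁ , t₂ , refl , refl ∷ s₁ , s₂

  module MaximumFirst (m : ℕ) where

    private
      M : ℕ
      M = suc m

    prependMax-∈ : ∀ {β} → β ∈ Av M → M ∷ β ∈ Av (suc M)
    prependMax-∈ {β} β∈ = ∈-Av⁺ (suc M) (isPermutation (cong suc (length≡ isP)) bnd cov)
                            (Avoids-subst (sym (avoids-max M β (All.tabulate (bounded isP)))) (proj₂ (∈-Av⁻ M β∈)))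
      where
      isP : IsPermutation M β
      isP = proj₁ (∈-Av⁻ M β∈)
      bnd : ∀ {x} → x ∈ M ∷ β → x < suc M
      bnd (here refl) = ℕₚ.≤-refl
      bnd (there x∈)  = ℕₚ.<-trans (bounded isP x∈) ℕₚ.≤-refl
      cov : ∀ v → v < suc M → v ∈ M ∷ β
      cov v v< with ℕₚ.<-cmp v M
      ... | tri< v<M _ _ = there (covers isP v v<M)
      ... | tri≈ _ refl _ = here refl
      ... | tri> _ _ M<v = ⊥-elim (ℕₚ.<⇒≱ M<v (ℕₚ.≤-pred v<))

    prependMax-∈⁻ : ∀ {β} → M ∷ β ∈ Av (suc M) → β ∈ Av M
    prependMax-∈⁻ {β} π∈ = ∈-Av⁺ M (isPermutation (ℕₚ.suc-injective (length≡ isP)) β<M cov)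
                             (Avoids-subst (avoids-max M β (All.tabulate β<M)) (proj₂ (∈-Av⁻ (suc M) π∈)))
      where
      isP : IsPermutation (suc M) (M ∷ β)
      isP = proj₁ (∈-Av⁻ (suc M) π∈)
      M∉β : M ∉ β
      M∉β = Uniqueₚ.Unique[x∷xs]⇒x∉xs (permutation-unique isP)
      β<M : ∀ {x} → x ∈ β → x < M
      β<M {x} x∈ with ℕₚ.<-cmp x M
      ... | tri< x<M _ _ = x<M
      ... | tri≈ _ refl _ = ⊥-elim (M∉β x∈)
      ... | tri> _ _ M<x = ⊥-elim (ℕₚ.<⇒≱ M<x (ℕₚ.≤-pred (bounded isP (there x∈))))
      cov : ∀ v → v < M → v ∈ β
      cov v v<M with covers isP v (ℕₚ.<-trans v<M ℕₚ.≤-refl)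
      ... | here refl = ⊥-elim (ℕₚ.<-irrefl refl v<M)
      ... | there v∈ = v∈

  -- The position of the first occurrence of M in l (the length of l if M does not occur).
  indexOf : ℕ → List ℕ → ℕ
  indexOf M []      = 0
  indexOf M (x ∷ l) = if x ≡ᵇ M then 0 else suc (indexOf M l)

  indexOf-here : ∀ M l → indexOf M (M ∷ l) ≡ 0
  indexOf-here M l rewrite ≡ᵇ-refl M = refl

  indexOf-++ : ∀ M xs ys → All (_< M) xs → indexOf M (xs ++ M ∷ ys) ≡ length xs
  indexOf-++ M []       ys []          = indexOf-here M ys
  indexOf-++ M (x ∷ xs) ys (x<M ∷ xs<M) rewrite ≡ᵇ-≢ x M (ℕₚ.<⇒≢ x<M) = cong suc (indexOf-++ M xs ys xs<M)

  -- For i ≤ m and a = m - i, build m i σ β is  σ shifted to {a+1, …, m},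
  -- then a, then the maximum m+1, then β: the maximum stands at position i+1.
  build : ℕ → ℕ → List ℕ → List ℕ → List ℕ
  build m i σ β = shift (suc (m ∸ i)) σ ++ (m ∸ i) ∷ suc m ∷ β

  module Build (m i : ℕ) (i≤m : i ≤ m) {σ β : List ℕ} (σ∈ : σ ∈ Av i) (β∈ : β ∈ Av (m ∸ i)) where

    private
      a M : ℕ
      a = m ∸ i
      M = suc m
      S : List ℕ
      S = shift (suc a) σ
      isPσ : IsPermutation i σ
      isPσ = proj₁ (∈-Av⁻ i σ∈)
      isPβ : IsPermutation a β
      isPβ = proj₁ (∈-Av⁻ a β∈)
      avS : Avoids S
      avS = Avoids-subst (sym (avoids-shift (suc a) σ)) (proj₂ (∈-Av⁻ i σ∈))
      avβ : Avoids β
      avβ = proj₂ (∈-Av⁻ a β∈)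

      i+a≡m : i + a ≡ m
      i+a≡m = ℕₚ.m+[n∸m]≡n i≤m

      a<M : a < M
      a<M = s≤s (ℕₚ.m∸n≤m m i)

      -- The three value ranges: β < a < S < M.
      S-range : ∀ {x} → x ∈ S → a < x × x < M
      S-range x∈ with y , y∈ , refl ← ∈-map⁻ _ x∈ =
        s≤s (ℕₚ.m≤m+n a y) , s≤s (subst (a + y <_) (trans (ℕₚ.+-comm a i) i+a≡m) (ℕₚ.+-monoʳ-< a (bounded isPσ y∈)))

      β<a : ∀ {x} → x ∈ β → x < a
      β<a = bounded isPβ

      β<M : ∀ {x} → x ∈ β → x < M
      β<M x∈ = ℕₚ.<-trans (β<a x∈) a<M

      tail-range : ∀ {w} → w ∈ a ∷ M ∷ β → w ≡ M ⊎ w ≤ a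
      tail-range (here refl)         = inj₂ ℕₚ.≤-refl
      tail-range (there (here refl)) = inj₁ refl
      tail-range (there (there w∈))  = inj₂ (ℕₚ.<⇒≤ (β<a w∈))

      tail≤M : ∀ {w} → w ∈ a ∷ M ∷ β → w ≤ M
      tail≤M w∈ with tail-range w∈
      ... | inj₁ refl = ℕₚ.≤-refl
      ... | inj₂ w≤a  = ℕₚ.≤-trans w≤a (ℕₚ.<⇒≤ a<M)

      -- A 132 cannot use entries from both sides of the split S | a M β, and
      -- neither side contains one.
      build-no132 : ¬ Occ132 (S ++ a ∷ M ∷ β)
      build-no132 (occ132 {x} {y} {z} s x<z z<y) with ⊑-split S s
      ... | t₁ , t₂ , eq , s₁ , s₂ = by-split t₁ t₂ eq s₁ s₂
        where
        by-split : ∀ t₁ t₂ → x ∷ y ∷ z ∷ [] ≡ t₁ ++ t₂ → t₁ ⊑ S → t₂ ⊑ a ∷ M ∷ β → ⊥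
        by-split [] _ refl _ (refl ∷ (refl ∷ s₃)) = ℕₚ.<-asym x<z (β<a (to∈ s₃))
        by-split [] _ refl _ (refl ∷ (_ ∷ʳ s₃))   = ℕₚ.<-asym x<z (β<a (to∈ (∷ˡ⁻ s₃)))
        by-split [] _ refl _ (_ ∷ʳ (refl ∷ s₃))   = ℕₚ.<-asym x<z (β<M (to∈ (∷ˡ⁻ s₃)))
        by-split [] _ refl _ (_ ∷ʳ (_ ∷ʳ s₃))     = no132 avβ (occ132 s₃ x<z z<y)
        by-split (_ ∷ []) _ refl s₁ s₂ with tail-range (to∈ (∷ˡ⁻ s₂))
        ... | inj₁ refl = ℕₚ.<⇒≱ z<y (tail≤M (to∈ s₂))
        ... | inj₂ z≤a  = ℕₚ.<⇒≱ (ℕₚ.<-trans (proj₁ (S-range (to∈ s₁))) x<z) z≤a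
        by-split (_ ∷ _ ∷ []) _ refl s₁ s₂ with tail-range (to∈ s₂)
        ... | inj₁ refl = ℕₚ.<-asym z<y (proj₂ (S-range (to∈ (∷ˡ⁻ s₁))))
        ... | inj₂ z≤a  = ℕₚ.<⇒≱ (ℕₚ.<-trans (proj₁ (S-range (to∈ s₁))) x<z) z≤a
        by-split (_ ∷ _ ∷ _ ∷ []) [] refl s₁ _ = no132 avS (occ132 s₁ x<z z<y)

      -- Consecutive triples straddling the split are never increasing.
      build-no123 : ¬ Consec123 (S ++ a ∷ M ∷ β)
      build-no123 c with Equivalence.to T-∨ (subst T (consec123-valley a M a<M S β (All.tabulate S-range) (All.tabulate β<M))
                                        (consec123-complete c))
      ... | inj₁ inS = no123 avS (consec123-sound S inS)
      ... | inj₂ inβ = no123 avβ (consec123-sound β inβ)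

    build-occ213 : occ213 (build m i σ β) ≡ occ213 σ + nonEmpty σ + occ213 β
    build-occ213 = trans (occ213-valley a M a<M S β (All.tabulate S-range) (All.tabulate β<M))
                         (cong₂ (λ u v → u + v + occ213 β) (occ213-shift (suc a) σ) (nonEmpty-shift σ))
      where
      nonEmpty-shift : ∀ σ → nonEmpty (shift (suc a) σ) ≡ nonEmpty σ
      nonEmpty-shift []      = refl
      nonEmpty-shift (_ ∷ _) = refl

    private
      length-S : length S ≡ i
      length-S = trans (Listₚ.length-map _ σ) (length≡ isPσ)

      build-length : length (build m i σ β) ≡ suc (suc m)
      build-length = begin
        length (S ++ a ∷ M ∷ β)            ≡⟨ Listₚ.length-++ S ⟩
        length S + suc (suc (length β))    ≡⟨ cong₂ (λ u v → u + suc (suc v)) length-S (length≡ isPβ) ⟩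
        i + suc (suc a)                    ≡⟨ ℕₚ.+-suc i (suc a) ⟩
        suc (i + suc a)                    ≡⟨ cong suc (ℕₚ.+-suc i a) ⟩
        suc (suc (i + a))                  ≡⟨ cong (suc ∘ suc) i+a≡m ⟩
        suc (suc m)                        ∎
        where open ≡-Reasoning

      build-bounded : ∀ {x} → x ∈ build m i σ β → x < suc M
      build-bounded x∈ with ∈-++⁻ S x∈
      ... | inj₁ x∈S = ℕₚ.<-trans (proj₂ (S-range x∈S)) ℕₚ.≤-refl
      ... | inj₂ x∈T = s≤s (tail≤M x∈T)

      build-covers : ∀ v → v < suc M → v ∈ build m i σ β
      build-covers v v< with ℕₚ.<-cmp v a
      ... | tri< v<a _ _ = ∈-++⁺ʳ S (there (there (covers isPβ v v<a)))
      ... | tri≈ _ refl _ = ∈-++⁺ʳ S (here refl)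
      ... | tri> _ _ a<v with ℕₚ.<-cmp v M
      ...   | tri≈ _ refl _ = ∈-++⁺ʳ S (there (here refl))
      ...   | tri> _ _ M<v = ⊥-elim (ℕₚ.<⇒≱ M<v (ℕₚ.≤-pred v<))
      ...   | tri< v<M _ _ = ∈-++⁺ˡ (subst (_∈ S) (ℕₚ.m+[n∸m]≡n a<v) (∈-map⁺ (suc a +_) (covers isPσ (v ∸ suc a) v-a<i)))
        where
        v-a<i : v ∸ suc a < i
        v-a<i = ℕₚ.+-cancelˡ-< (suc a) (v ∸ suc a) i
          (subst₂ _<_ (sym (ℕₚ.m+[n∸m]≡n a<v)) (cong suc (trans (sym i+a≡m) (ℕₚ.+-comm i a))) v<M)

    build-∈ : build m i σ β ∈ Av (suc M)
    build-∈ = ∈-Av⁺ (suc M) (isPermutation build-length build-bounded build-covers) (avoiding build-no132 build-no123)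

    build-position : indexOf M (build m i σ β) ≡ suc i
    build-position = begin
      indexOf M (S ++ a ∷ M ∷ β)        ≡⟨ cong (indexOf M) (sym (Listₚ.∷ʳ-++ S a (M ∷ β))) ⟩
      indexOf M ((S ++ [ a ]) ++ M ∷ β) ≡⟨ indexOf-++ M (S ++ [ a ]) β prefix<M ⟩
      length (S ++ [ a ])               ≡⟨ Listₚ.length-++ S ⟩
      length S + 1                      ≡⟨ cong (_+ 1) length-S ⟩
      i + 1                             ≡⟨ ℕₚ.+-comm i 1 ⟩
      suc i                             ∎
      where
      open ≡-Reasoning
      prefix<M : All (_< M) (S ++ [ a ])
      prefix<M = Allₚ.++⁺ (All.tabulate (proj₂ ∘ S-range)) (a<M ∷ [])

  build-injective : ∀ m i {σ σ′ β β′} → length σ ≡ length σ′ →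
                    build m i σ β ≡ build m i σ′ β′ → σ ≡ σ′ × β ≡ β′
  build-injective m i {σ} {σ′} len eq
    with eσ , eβ ← ++-cancel-length (shift (suc (m ∸ i)) σ) (shift (suc (m ∸ i)) σ′)
                     (trans (Listₚ.length-map _ σ) (trans len (sym (Listₚ.length-map _ σ′)))) eq
    = Listₚ.map-injective (ℕₚ.+-cancelˡ-≡ (suc (m ∸ i)) _ _) eσ , Listₚ.∷-injectiveʳ (Listₚ.∷-injectiveʳ eβ)

  -- Conversely, let π = S a M β ∈ Av (m+2), M = m+1 the maximum, with S a
  -- the (non-empty) prefix before M.  Then β < a < S, so π = build m |S| σ β
  -- for σ, β in the smaller classes.
  module Decomposition (m : ℕ) {S : List ℕ} {a : ℕ} {β : List ℕ} (π∈ : S ++ a ∷ suc m ∷ β ∈ Av (suc (suc m))) where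

    M : ℕ
    M = suc m
    π : List ℕ
    π = S ++ a ∷ M ∷ β

    private
      isP : IsPermutation (suc M) π
      isP = proj₁ (∈-Av⁻ (suc M) π∈)
      avπ : Avoids π
      avπ = proj₂ (∈-Av⁻ (suc M) π∈)
      uπ : Unique π
      uπ = permutation-unique isP

      a∉ : a ∉ S ++ M ∷ β
      a∉ = unique-middle S uπ

      M∉ : M ∉ (S ++ [ a ]) ++ β
      M∉ = unique-middle (S ++ [ a ]) (subst Unique (sym (Listₚ.∷ʳ-++ S a (M ∷ β))) uπ)

      below-M : ∀ {w} → w ∈ π → w ≢ M → w < M
      below-M {w} w∈ w≢M with ℕₚ.<-cmp w M
      ... | tri< w<M _ _ = w<M
      ... | tri≈ _ w≡M _ = contradiction w≡M w≢M
      ... | tri> _ _ M<w = ⊥-elim (ℕₚ.<⇒≱ M<w (ℕₚ.≤-pred (bounded isP w∈)))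

      inβ : ∀ {w} → w ∈ β → w ∈ π
      inβ w∈ = ∈-++⁺ʳ S (there (there w∈))

      β<M : ∀ {y} → y ∈ β → y < M
      β<M y∈ = below-M (inβ y∈) (λ { refl → M∉ (∈-++⁺ʳ (S ++ [ a ]) y∈) })

      S<M : ∀ {x} → x ∈ S → x < M
      S<M x∈ = below-M (∈-++⁺ˡ x∈) (λ { refl → M∉ (∈-++⁺ˡ (∈-++⁺ˡ x∈)) })

    a<M : a < M
    a<M = below-M (∈-++⁺ʳ S (here refl)) (λ { refl → a∉ (∈-++⁺ʳ S (here refl)) })

    -- Entries after the maximum lie below a: otherwise a M y would be a 132.
    β<a : ∀ {y} → y ∈ β → y < a
    β<a {y} y∈ with ℕₚ.<-cmp a y
    ... | tri< a<y _ _ = ⊥-elim (no132 avπ (occ132 (++⁺ˡ S (refl ∷ refl ∷ from∈ y∈)) a<y (β<M y∈)))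
    ... | tri≈ _ refl _ = ⊥-elim (a∉ (∈-++⁺ʳ S (there y∈)))
    ... | tri> _ _ y<a = y<a

    -- Entries before a lie above a.  Let y be the last entry of S: y < a would
    -- make y a M a consecutive 123, and an x < a before y > a would make x y a a 132.
    a<S : ∀ {x} → x ∈ S → a < x
    a<S {x} x∈ with ℕₚ.<-cmp a x
    ... | tri< a<x _ _ = a<x
    ... | tri≈ _ refl _ = ⊥-elim (a∉ (∈-++⁺ˡ x∈))
    ... | tri> _ _ x<a = ⊥-elim (last-entry S refl x∈)
      where
      last-entry : ∀ S′ → S′ ≡ S → x ∈ S′ → ⊥
      last-entry S′ S′≡S x∈S′ with initLast S′
      last-entry .(R ++ [ y ]) refl x∈S′ | R ∷ʳ′ y with ℕₚ.<-cmp y a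
      ... | tri≈ _ refl _ = a∉ (∈-++⁺ˡ (∈-++⁺ʳ R (here refl)))
      ... | tri< y<a _ _ = no123 avπ (consec123 R β (Listₚ.∷ʳ-++ R y (a ∷ M ∷ β)) y<a a<M)
      ... | tri> _ _ a<y with ∈-++⁻ R x∈S′
      ...   | inj₂ (here refl) = ℕₚ.<-asym a<y x<a
      ...   | inj₁ x∈R = no132 avπ (occ132 x-y-a x<a a<y)
        where
        x-y-a : x ∷ y ∷ a ∷ [] ⊑ (R ++ [ y ]) ++ a ∷ M ∷ β
        x-y-a = subst (x ∷ y ∷ a ∷ [] ⊑_) (sym (Listₚ.++-assoc R (y ∷ []) (a ∷ M ∷ β)))
                  (++⁺ (from∈ x∈R) (refl ∷ refl ∷ []⊆-universal (M ∷ β)))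

    private
      classify : ∀ {w} → w ∈ π → w ∈ S ⊎ w ≡ a ⊎ w ≡ M ⊎ w ∈ β
      classify w∈ with ∈-++⁻ S w∈
      ... | inj₁ w∈S                  = inj₁ w∈S
      ... | inj₂ (here refl)          = inj₂ (inj₁ refl)
      ... | inj₂ (there (here refl))  = inj₂ (inj₂ (inj₁ refl))
      ... | inj₂ (there (there w∈β))  = inj₂ (inj₂ (inj₂ w∈β))

      β-covers : ∀ v → v < a → v ∈ β
      β-covers v v<a with classify (covers isP v (ℕₚ.<-trans (ℕₚ.<-trans v<a a<M) ℕₚ.≤-refl))
      ... | inj₁ v∈S               = ⊥-elim (ℕₚ.<-asym v<a (a<S v∈S))
      ... | inj₂ (inj₁ refl)       = ⊥-elim (ℕₚ.<-irrefl refl v<a)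
      ... | inj₂ (inj₂ (inj₁ refl)) = ⊥-elim (ℕₚ.<-asym v<a a<M)
      ... | inj₂ (inj₂ (inj₂ v∈β)) = v∈β

      β-length : length β ≡ a
      β-length = trans (unique-length-≡ uβ (Uniqueₚ.upTo⁺ a) (∈-upTo⁺ ∘ β<a) (β-covers _ ∘ ∈-upTo⁻))
                       (Listₚ.length-upTo a)
        where
        π≡ : (S ++ a ∷ M ∷ []) ++ β ≡ π
        π≡ = Listₚ.++-assoc S (a ∷ M ∷ []) β
        uβ : Unique β
        uβ = unique-suffix (S ++ a ∷ M ∷ []) (subst Unique (sym π≡) uπ)

      β-avoids : Avoids β
      β-avoids = avoids-factor (S ++ a ∷ M ∷ []) β [] (subst Avoids π≡ avπ)
        where
        π≡ : π ≡ (S ++ a ∷ M ∷ []) ++ β ++ []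
        π≡ = trans (cong (λ l → S ++ a ∷ M ∷ l) (sym (Listₚ.++-identityʳ β))) (sym (Listₚ.++-assoc S (a ∷ M ∷ []) (β ++ [])))

    -- The position of the maximum, minus one.
    i : ℕ
    i = length S

    private
      i+a≡m : i + a ≡ m
      i+a≡m = ℕₚ.suc-injective (ℕₚ.suc-injective (trans (sym length-π) (length≡ isP)))
        where
        length-π : length π ≡ suc (suc (i + a))
        length-π = begin
          length π                         ≡⟨ Listₚ.length-++ S ⟩
          length S + suc (suc (length β))  ≡⟨ cong (λ v → i + suc (suc v)) β-length ⟩
          i + suc (suc a)                  ≡⟨ ℕₚ.+-suc i (suc a) ⟩
          suc (i + suc a)                  ≡⟨ cong suc (ℕₚ.+-suc i a) ⟩
          suc (suc (i + a))                ∎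
          where open ≡-Reasoning

    i≤m : i ≤ m
    i≤m = subst (i ≤_) i+a≡m (ℕₚ.m≤m+n i a)

    private
      m∸i≡a : m ∸ i ≡ a
      m∸i≡a = trans (cong (_∸ i) (sym i+a≡m)) (ℕₚ.m+n∸m≡n i a)

    σ : List ℕ
    σ = map (_∸ suc a) S

    private
      shift-σ : shift (suc a) σ ≡ S
      shift-σ = trans (sym (Listₚ.map-∘ S)) (Listₚ.map-id-local (All.tabulate (ℕₚ.m+[n∸m]≡n ∘ a<S)))

      σ-bounded : ∀ {y} → y ∈ σ → y < i
      σ-bounded y∈ with x , x∈S , refl ← ∈-map⁻ _ y∈ = ℕₚ.+-cancelʳ-< (suc a) (x ∸ suc a) i x<i+1+a
        where
        x<i+1+a : x ∸ suc a + suc a < i + suc a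
        x<i+1+a = subst₂ _<_ (sym (ℕₚ.m∸n+n≡m (a<S x∈S))) (sym (trans (ℕₚ.+-suc i a) (cong suc i+a≡m))) (S<M x∈S)

      σ-covers : ∀ v → v < i → v ∈ σ
      σ-covers v v<i with classify (covers isP (suc a + v) (s≤s a+v<M))
        where
        a+v<M : a + v < M
        a+v<M = ℕₚ.<-trans (subst (a + v <_) (trans (ℕₚ.+-comm a i) i+a≡m) (ℕₚ.+-monoʳ-< a v<i)) ℕₚ.≤-refl
      ... | inj₁ w∈S               = subst (_∈ σ) (ℕₚ.m+n∸m≡n (suc a) v) (∈-map⁺ (_∸ suc a) w∈S)
      ... | inj₂ (inj₁ 1+a+v≡a)    = ⊥-elim (ℕₚ.<-irrefl (sym 1+a+v≡a) (s≤s (ℕₚ.m≤m+n a v)))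
      ... | inj₂ (inj₂ (inj₁ e))   = ⊥-elim (ℕₚ.<-irrefl v≡i v<i)
        where
        v≡i : v ≡ i
        v≡i = ℕₚ.+-cancelˡ-≡ a v i (trans (ℕₚ.suc-injective e) (sym (trans (ℕₚ.+-comm a i) i+a≡m)))
      ... | inj₂ (inj₂ (inj₂ w∈β)) = ⊥-elim (ℕₚ.<-asym (β<a w∈β) (s≤s (ℕₚ.m≤m+n a v)))

      σ-avoids : Avoids σ
      σ-avoids = Avoids-subst (avoids-shift (suc a) σ) (subst Avoids (sym shift-σ) (avoids-factor [] S (a ∷ M ∷ β) avπ))

    σ∈ : σ ∈ Av i
    σ∈ = ∈-Av⁺ i (isPermutation (Listₚ.length-map _ S) σ-bounded σ-covers) σ-avoids

    β∈ : β ∈ Av (m ∸ i)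
    β∈ = subst (λ k → β ∈ Av k) (sym m∸i≡a)
           (∈-Av⁺ a (isPermutation β-length β<a β-covers) β-avoids)

    decomposition : π ≡ build m i σ β
    decomposition rewrite m∸i≡a | shift-σ = refl

  -- Av (m+2) split by the position of the maximum m+1: position 0 gives
  -- m+1 β with β ∈ Av (m+1); position i+1 gives build m i σ β.
  block : ℕ → ℕ → List (List ℕ)
  block m zero    = map (suc m ∷_) (Av (suc m))
  block m (suc i) = map (uncurry (build m i)) (cartesianProduct (Av i) (Av (m ∸ i)))

  decomposed : ℕ → List (List ℕ)
  decomposed m = concatMap (block m) (upTo (suc (suc m)))

  ∈-decomposed : ∀ m i {π} → i < suc (suc m) → π ∈ block m i → π ∈ decomposed m
  ∈-decomposed m i i<m+2 π∈ = ∈-concatMap⁺ (block m) {xs = upTo (suc (suc m))} (lose (∈-upTo⁺ i<m+2) π∈)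

  decomposed⊆Av : ∀ m → decomposed m ⊆ Av (suc (suc m))
  decomposed⊆Av m π∈ with find (∈-concatMap⁻ (block m) {xs = upTo (suc (suc m))} π∈)
  ... | zero , _ , π∈block with β , β∈ , refl ← ∈-map⁻ _ π∈block = MaximumFirst.prependMax-∈ m β∈
  ... | suc i , i<m+2 , π∈block
    with (σ , β) , σβ∈ , refl ← ∈-map⁻ _ π∈block
    with σ∈ , β∈ ← ∈-cartesianProduct⁻ (Av i) (Av (m ∸ i)) σβ∈
    = Build.build-∈ m i (ℕₚ.≤-pred (ℕₚ.≤-pred (∈-upTo⁻ i<m+2))) σ∈ β∈

  Av⊆decomposed : ∀ m → Av (suc (suc m)) ⊆ decomposed m
  Av⊆decomposed m {π} π∈ with ∈-∃++ (covers (proj₁ (∈-Av⁻ (suc (suc m)) π∈)) (suc m) ℕₚ.≤-refl)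
  ... | α , β , refl with initLast α
  ...   | [] = ∈-decomposed m 0 (s≤s z≤n) (∈-map⁺ (suc m ∷_) (MaximumFirst.prependMax-∈⁻ m π∈))
  ...   | S ∷ʳ′ a = subst (_∈ decomposed m) (trans (sym decomposition) (sym (Listₚ.∷ʳ-++ S a (suc m ∷ β))))
                      (∈-decomposed m (suc i) (s≤s (s≤s i≤m)) (∈-map⁺ (uncurry (build m i)) (∈-cartesianProduct⁺ σ∈ β∈)))
    where open Decomposition m (subst (_∈ Av (suc (suc m))) (Listₚ.∷ʳ-++ S a (suc m ∷ β)) π∈)

  -- The blocks are duplicate-free and disjoint: the position of the maximum identifies the block.
  unique-decomposed : ∀ m → Unique (decomposed m)
  unique-decomposed m =
    unique-concatMap (block m) (indexOf (suc m)) (upTo (suc (suc m))) (Uniqueₚ.upTo⁺ _) unique-block position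
    where
    unique-block : ∀ {i} → i ∈ upTo (suc (suc m)) → Unique (block m i)
    unique-block {zero}  _ = Uniqueₚ.map⁺ (λ { refl → refl }) (unique-Av (suc m))
    unique-block {suc i} _ =
      unique-map (uncurry (build m i)) (Uniqueₚ.cartesianProduct⁺ (unique-Av i) (unique-Av (m ∸ i))) injective
      where
      injective : ∀ {p q} → p ∈ cartesianProduct (Av i) (Av (m ∸ i)) → q ∈ cartesianProduct (Av i) (Av (m ∸ i)) →
                  uncurry (build m i) p ≡ uncurry (build m i) q → p ≡ q
      injective {σ , β} {σ′ , β′} p∈ q∈ eq
        with σ∈ , _ ← ∈-cartesianProduct⁻ (Av i) (Av (m ∸ i)) p∈
        with σ′∈ , _ ← ∈-cartesianProduct⁻ (Av i) (Av (m ∸ i)) q∈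
        with refl , refl ← build-injective m i
                             (trans (length≡ (proj₁ (∈-Av⁻ i σ∈))) (sym (length≡ (proj₁ (∈-Av⁻ i σ′∈))))) eq
        = refl
    position : ∀ {i π} → i ∈ upTo (suc (suc m)) → π ∈ block m i → indexOf (suc m) π ≡ i
    position {zero}  _ π∈ with β , _ , refl ← ∈-map⁻ _ π∈ = indexOf-here (suc m) β
    position {suc i} i<m+2 π∈
      with (σ , β) , σβ∈ , refl ← ∈-map⁻ _ π∈
      with σ∈ , β∈ ← ∈-cartesianProduct⁻ (Av i) (Av (m ∸ i)) σβ∈
      = Build.build-position m i (ℕₚ.≤-pred (ℕₚ.≤-pred (∈-upTo⁻ i<m+2))) σ∈ β∈

  avCount : ℕ → ℕ → ℕ
  avCount n k = fibre occ213 k (Av n)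

  coeff≡avCount : ∀ n k → coeff n k ≡ avCount n k
  coeff≡avCount n k = count-filter avoids (λ π → occ213 π ≡ᵇ k) (perms n)

  avCount-blocks : ∀ m k → avCount (suc (suc m)) k ≡ ∑ (suc (suc m)) (λ i → fibre occ213 k (block m i))
  avCount-blocks m k = begin
    fibre occ213 k (Av (suc (suc m)))
      ≡⟨ count-same-elements (λ π → occ213 π ≡ᵇ k) (unique-Av (suc (suc m))) (unique-decomposed m)
                             (Av⊆decomposed m) (decomposed⊆Av m) ⟩
    fibre occ213 k (decomposed m)
      ≡⟨ count-concatMap _ (block m) (upTo (suc (suc m))) ⟩
    sum (map (fibre occ213 k ∘ block m) (upTo (suc (suc m))))
      ≡⟨ cong sum (Listₚ.map-upTo (fibre occ213 k ∘ block m) (suc (suc m))) ⟩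
    ∑ (suc (suc m)) (λ i → fibre occ213 k (block m i))  ∎
    where open ≡-Reasoning

  -- Block 0 counts Av (m+1): the prepended maximum adds no 213.
  block-first : ∀ m k → fibre occ213 k (block m 0) ≡ avCount (suc m) k
  block-first m k = trans (count-map (λ π → occ213 π ≡ᵇ k) (suc m ∷_) (Av (suc m)))
    (count-cong (λ β → occ213 (suc m ∷ β) ≡ᵇ k) (λ β → occ213 β ≡ᵇ k) (Av (suc m)) λ {β} β∈ →
       cong (_≡ᵇ k) (occ213-max (suc m) β (All.tabulate (bounded (proj₁ (∈-Av⁻ (suc m) β∈))))))

  pairStat : List ℕ × List ℕ → ℕ
  pairStat p = occ213 (proj₁ p) + nonEmpty (proj₁ p) + occ213 (proj₂ p)

  block-pairs : ∀ m i K → i ≤ m → fibre occ213 K (block m (suc i)) ≡ fibre pairStat K (cartesianProduct (Av i) (Av (m ∸ i)))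
  block-pairs m i K i≤m = trans (count-map (λ π → occ213 π ≡ᵇ K) (uncurry (build m i)) (cartesianProduct (Av i) (Av (m ∸ i))))
    (count-cong (λ p → occ213 (uncurry (build m i) p) ≡ᵇ K) (λ p → pairStat p ≡ᵇ K) _ λ {(σ , β)} σβ∈ →
       let σ∈ , β∈ = ∈-cartesianProduct⁻ (Av i) (Av (m ∸ i)) σβ∈ in cong (_≡ᵇ K) (Build.build-occ213 m i i≤m σ∈ β∈))

  block-second : ∀ m k → fibre occ213 k (block m 1) ≡ avCount m k
  block-second m k = begin
    fibre occ213 k (block m 1)                       ≡⟨ block-pairs m 0 k z≤n ⟩
    fibre pairStat k (map ([] ,_) (Av m) ++ [])     ≡⟨ cong (fibre pairStat k) (Listₚ.++-identityʳ (map ([] ,_) (Av m))) ⟩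
    fibre pairStat k (map ([] ,_) (Av m))           ≡⟨ count-map (λ p → pairStat p ≡ᵇ k) ([] ,_) (Av m) ⟩
    avCount m k                                      ∎
    where open ≡-Reasoning

  -- For σ non-empty, (last σ, a, M) is one more 213.
  pairStat-nonEmpty : ∀ i {σ} β → σ ∈ Av (suc i) → pairStat (σ , β) ≡ suc (occ213 σ + occ213 β)
  pairStat-nonEmpty i {σ} β σ∈ with σ | length≡ (proj₁ (∈-Av⁻ (suc i) σ∈))
  ... | x ∷ σ′ | _ = cong (_+ occ213 β) (ℕₚ.+-comm (occ213 (x ∷ σ′)) 1)

  block-later : ∀ m i k → suc i ≤ m → fibre occ213 (suc k) (block m (suc (suc i))) ≡
    ∑ (suc k) (λ j → avCount (suc i) j * avCount (m ∸ suc i) (k ∸ j))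
  block-later m i k i<m = begin
    fibre occ213 (suc k) (block m (suc (suc i)))
      ≡⟨ block-pairs m (suc i) (suc k) i<m ⟩
    fibre pairStat (suc k) pairs
      ≡⟨ count-cong (λ p → pairStat p ≡ᵇ suc k) (λ p → (occ213 (proj₁ p) + occ213 (proj₂ p)) ≡ᵇ k) pairs
           (λ {(σ , β)} σβ∈ → cong (_≡ᵇ suc k) (pairStat-nonEmpty i β (proj₁ (∈-cartesianProduct⁻ (Av (suc i)) _ σβ∈)))) ⟩
    count (λ p → (occ213 (proj₁ p) + occ213 (proj₂ p)) ≡ᵇ k) pairs
      ≡⟨ fibre-pairs occ213 occ213 (Av (suc i)) (Av (m ∸ suc i)) k ⟩
    ∑ (suc k) (λ j → avCount (suc i) j * avCount (m ∸ suc i) (k ∸ j)) ∎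
    where
    open ≡-Reasoning
    pairs : List (List ℕ × List ℕ)
    pairs = cartesianProduct (Av (suc i)) (Av (m ∸ suc i))

  block-later-zero : ∀ m i → suc i ≤ m → fibre occ213 0 (block m (suc (suc i))) ≡ 0
  block-later-zero m i i<m = trans (block-pairs m (suc i) 0 i<m)
    (count-none (λ p → pairStat p ≡ᵇ 0) (cartesianProduct (Av (suc i)) (Av (m ∸ suc i))) λ {(σ , β)} σβ∈ →
       subst (λ n → ¬ T (n ≡ᵇ 0)) (sym (pairStat-nonEmpty i β (proj₁ (∈-cartesianProduct⁻ (Av (suc i)) _ σβ∈)))) λ ())

  -- The coefficient of x^m t^k in the square of Σ c(n,k) x^n t^k.
  convolution : (ℕ → ℕ → ℕ) → ℕ → ℕ → ℕ
  convolution c m k = ∑ (suc m) (λ i → ∑ (suc k) (λ j → c i j * c (m ∸ i) (k ∸ j)))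

  laterBlocks : ℕ → ℕ → ℕ
  laterBlocks m k = ∑ m (λ i → ∑ (suc k) (λ j → avCount (suc i) j * avCount (m ∸ suc i) (k ∸ j)))

  -- Only the empty permutation has length 0, so the i = 0 term of the convolution is c(m,k).
  convolution-split : ∀ m k → convolution avCount m k ≡ avCount m k + laterBlocks m k
  convolution-split m k = cong (_+ laterBlocks m k) (begin
    avCount m k + 0 * avCount m (k ∸ 0) + ∑ k (λ j → 0)   ≡⟨ cong (avCount m k + 0 +_) (∑-zero k (λ _ → 0) (λ _ _ → refl)) ⟩
    avCount m k + 0 + 0                                   ≡⟨ trans (ℕₚ.+-identityʳ _) (ℕₚ.+-identityʳ _) ⟩
    avCount m k                                           ∎)
    where open ≡-Reasoning

  avCount-split : ∀ m k → avCount (suc (suc m)) k ≡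
                          avCount (suc m) k + (avCount m k + ∑ m (λ i → fibre occ213 k (block m (suc (suc i)))))
  avCount-split m k = trans (avCount-blocks m k)
    (cong₂ (λ u v → u + (v + ∑ m (λ i → fibre occ213 k (block m (suc (suc i)))))) (block-first m k) (block-second m k))

  avCount-rec-zero : ∀ m → avCount (suc (suc m)) 0 ≡ avCount (suc m) 0 + avCount m 0
  avCount-rec-zero m = begin
    avCount (suc (suc m)) 0                                      ≡⟨ avCount-split m 0 ⟩
    avCount (suc m) 0 + (avCount m 0 + ∑ m later)               ≡⟨ cong (λ u → avCount (suc m) 0 + (avCount m 0 + u))
                                                                       (∑-zero m later (block-later-zero m)) ⟩
    avCount (suc m) 0 + (avCount m 0 + 0)                        ≡⟨ cong (avCount (suc m) 0 +_) (ℕₚ.+-identityʳ _) ⟩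
    avCount (suc m) 0 + avCount m 0                              ∎
    where
    open ≡-Reasoning
    later : ℕ → ℕ
    later i = fibre occ213 0 (block m (suc (suc i)))

  avCount-rec-suc : ∀ m k → avCount (suc (suc m)) (suc k) + avCount m k ≡
                            avCount (suc m) (suc k) + avCount m (suc k) + convolution avCount m k
  avCount-rec-suc m k = begin
    avCount (suc (suc m)) (suc k) + avCount m k       ≡⟨ cong (_+ avCount m k) (avCount-split m (suc k)) ⟩
    c₁ + (c₀ + ∑ m later) + avCount m k               ≡⟨ cong (λ u → c₁ + (c₀ + u) + avCount m k)
                                                            (∑-cong m later _ (λ i i<m → block-later m i k i<m)) ⟩
    c₁ + (c₀ + laterBlocks m k) + avCount m k         ≡⟨ rearrange c₁ c₀ (laterBlocks m k) (avCount m k) ⟩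
    c₁ + c₀ + (avCount m k + laterBlocks m k)         ≡⟨ cong (c₁ + c₀ +_) (sym (convolution-split m k)) ⟩
    c₁ + c₀ + convolution avCount m k                 ∎
    where
    open ≡-Reasoning
    later : ℕ → ℕ
    later i = fibre occ213 (suc k) (block m (suc (suc i)))
    c₁ c₀ : ℕ
    c₁ = avCount (suc m) (suc k)
    c₀ = avCount m (suc k)
    rearrange : ∀ a b x c → a + (b + x) + c ≡ a + b + (c + x)
    rearrange a b x c = begin
      a + (b + x) + c   ≡⟨ cong (_+ c) (sym (ℕₚ.+-assoc a b x)) ⟩
      a + b + x + c     ≡⟨ ℕₚ.+-assoc (a + b) x c ⟩
      a + b + (x + c)   ≡⟨ cong (a + b +_) (ℕₚ.+-comm x c) ⟩
      a + b + (c + x)   ∎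

  avCount-0 : ∀ k → avCount 0 k ≡ δ 0 k
  avCount-0 zero    = refl
  avCount-0 (suc k) = refl

  avCount-1 : ∀ k → avCount 1 k ≡ δ 0 k
  avCount-1 zero    = refl
  avCount-1 (suc k) = refl

-- The algebraic half: coefficient extraction for series over ℤ.
module SeriesIdentity where

  import Data.Nat as ℕ
  open import Data.Integer using (ℤ; +_; 1ℤ; -1ℤ; _+_; _*_; _-_)
  import Data.Integer.Properties as ℤₚ
  open import Data.Integer.Solver using (module +-*-Solver)
  open Enumeration using (module RangeSum; ∑; ≡ᵇ-refl; ≡ᵇ-≢; δ; convolution; avCount; coeff≡avCount)

  module ℤ∑ = RangeSum ℤₚ.+-0-commutativeMonoid

  pos-∑ : ∀ n f → + ∑ n f ≡ ℤ∑.∑ n (λ i → + f i)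
  pos-∑ zero    f = refl
  pos-∑ (suc n) f = trans (ℤₚ.pos-+ (f 0) (∑ n (f ∘ suc))) (cong (_+_ (+ f 0)) (pos-∑ n (f ∘ suc)))

  sumℤ-foldr : ∀ xs → sumℤ xs ≡ foldr _+_ 0ℤ xs
  sumℤ-foldr []       = refl
  sumℤ-foldr (x ∷ xs) = cong (_+_ x) (sumℤ-foldr xs)

  ⊗-coefficient : ∀ (f g : Series) n k → (f ⊗ g) n k ≡ ℤ∑.∑ (suc n) (λ i → ℤ∑.∑ (suc k) (λ j → f i j * g (n ∸ i) (k ∸ j)))
  ⊗-coefficient f g n k = begin
    sumℤ (map row (upTo (suc n)))         ≡⟨ sumℤ-foldr (map row (upTo (suc n))) ⟩
    foldr _+_ 0ℤ (map row (upTo (suc n))) ≡⟨ cong (foldr _+_ 0ℤ) (Listₚ.map-upTo row (suc n)) ⟩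
    ℤ∑.∑ (suc n) row                      ≡⟨ ℤ∑.∑-cong (suc n) row (λ i → ℤ∑.∑ (suc k) (term i)) (λ i _ → row≡ i) ⟩
    ℤ∑.∑ (suc n) (λ i → ℤ∑.∑ (suc k) (term i)) ∎
    where
    open ≡-Reasoning
    term : ℕ → ℕ → ℤ
    term i j = f i j * g (n ∸ i) (k ∸ j)
    row : ℕ → ℤ
    row i = sumℤ (map (term i) (upTo (suc k)))
    row≡ : ∀ i → row i ≡ ℤ∑.∑ (suc k) (term i)
    row≡ i = trans (sumℤ-foldr (map (term i) (upTo (suc k)))) (cong (foldr _+_ 0ℤ) (Listₚ.map-upTo (term i) (suc k)))

  ⊕-⊗ : ∀ (f g h : Series) n k → ((f ⊕ g) ⊗ h) n k ≡ (f ⊗ h) n k + (g ⊗ h) n k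
  ⊕-⊗ f g h n k = begin
    ((f ⊕ g) ⊗ h) n k
      ≡⟨ ⊗-coefficient (f ⊕ g) h n k ⟩
    ℤ∑.∑ (suc n) (λ i → ℤ∑.∑ (suc k) (λ j → (f i j + g i j) * H i j))
      ≡⟨ ℤ∑.∑-cong (suc n) _ (λ i → F i + G i) (λ i _ → row-distrib i) ⟩
    ℤ∑.∑ (suc n) (λ i → F i + G i)
      ≡⟨ ℤ∑.∑-distrib (suc n) F G ⟩
    ℤ∑.∑ (suc n) F + ℤ∑.∑ (suc n) G
      ≡⟨ sym (cong₂ _+_ (⊗-coefficient f h n k) (⊗-coefficient g h n k)) ⟩
    (f ⊗ h) n k + (g ⊗ h) n k ∎
    where
    open ≡-Reasoning
    H : ℕ → ℕ → ℤ
    H i j = h (n ∸ i) (k ∸ j)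
    F G : ℕ → ℤ
    F i = ℤ∑.∑ (suc k) (λ j → f i j * H i j)
    G i = ℤ∑.∑ (suc k) (λ j → g i j * H i j)
    row-distrib : ∀ i → ℤ∑.∑ (suc k) (λ j → (f i j + g i j) * H i j) ≡ F i + G i
    row-distrib i = trans (ℤ∑.∑-cong (suc k) _ (λ j → f i j * H i j + g i j * H i j)
                                      (λ j _ → ℤₚ.*-distribʳ-+ (H i j) (f i j) (g i j)))
                          (ℤ∑.∑-distrib (suc k) (λ j → f i j * H i j) (λ j → g i j * H i j))

  mono-hit : ∀ c p q → mono c p q p q ≡ c
  mono-hit c p q rewrite ≡ᵇ-refl p | ≡ᵇ-refl q = refl

  mono-miss : ∀ c p q i j → ¬ (i ≡ p × j ≡ q) → mono c p q i j ≡ 0ℤ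
  mono-miss c p q i j ne with i ℕ.≟ p | j ℕ.≟ q
  ... | yes refl | yes refl = contradiction (refl , refl) ne
  ... | no i≢p   | _        rewrite ≡ᵇ-≢ i p i≢p = refl
  ... | yes refl | no j≢q   rewrite ≡ᵇ-refl i | ≡ᵇ-≢ j q j≢q = refl

  mono-⊗ : ∀ c p q (g : Series) n k → p ≤ n → q ≤ k → (mono c p q ⊗ g) n k ≡ c * g (n ∸ p) (k ∸ q)
  mono-⊗ c p q g n k p≤n q≤k = begin
    (mono c p q ⊗ g) n k                      ≡⟨ ⊗-coefficient (mono c p q) g n k ⟩
    ℤ∑.∑ (suc n) (λ i → ℤ∑.∑ (suc k) (term i))
      ≡⟨ ℤ∑.∑-single (suc n) (λ i → ℤ∑.∑ (suc k) (term i)) p (s≤s p≤n)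
           (λ i _ i≢p → ℤ∑.∑-zero (suc k) (term i) (λ j _ → cong (_* _) (mono-miss c p q i j (i≢p ∘ proj₁)))) ⟩
    ℤ∑.∑ (suc k) (term p)
      ≡⟨ ℤ∑.∑-single (suc k) (term p) q (s≤s q≤k) (λ j _ j≢q → cong (_* _) (mono-miss c p q p j (j≢q ∘ proj₂))) ⟩
    mono c p q p q * g (n ∸ p) (k ∸ q)        ≡⟨ cong (_* g (n ∸ p) (k ∸ q)) (mono-hit c p q) ⟩
    c * g (n ∸ p) (k ∸ q)                     ∎
    where
    open ≡-Reasoning
    term : ℕ → ℕ → ℤ
    term i j = mono c p q i j * g (n ∸ i) (k ∸ j)

  mono-⊗-zero : ∀ c p q (g : Series) n k → n < p ⊎ k < q → (mono c p q ⊗ g) n k ≡ 0ℤ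
  mono-⊗-zero c p q g n k out = trans (⊗-coefficient (mono c p q) g n k)
    (ℤ∑.∑-zero (suc n) (λ i → ℤ∑.∑ (suc k) (term i)) λ i i≤n →
       ℤ∑.∑-zero (suc k) (term i) λ j j≤k → cong (_* g (n ∸ i) (k ∸ j)) (mono-miss c p q i j (outside i≤n j≤k)))
    where
    term : ℕ → ℕ → ℤ
    term i j = mono c p q i j * g (n ∸ i) (k ∸ j)
    outside : ∀ {i j} → i < suc n → j < suc k → ¬ (i ≡ p × j ≡ q)
    outside i≤n j≤k (refl , refl) = [ (λ n<p → ℕₚ.<⇒≱ n<p (ℕₚ.≤-pred i≤n)) , (λ k<q → ℕₚ.<⇒≱ k<q (ℕₚ.≤-pred j≤k)) ]′ out

  module QuadraticEquation
    (c : ℕ → ℕ → ℕ) (G : Series) (G≡ : ∀ n k → G n k ≡ + c n k)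
    (c-0 : ∀ k → c 0 k ≡ δ 0 k) (c-1 : ∀ k → c 1 k ≡ δ 0 k)
    (rec-zero : ∀ m → c (suc (suc m)) 0 ≡ c (suc m) 0 ℕ.+ c m 0)
    (rec-suc : ∀ m k → c (suc (suc m)) (suc k) ℕ.+ c m k ≡ c (suc m) (suc k) ℕ.+ c m (suc k) ℕ.+ convolution c m k)
    where

    G²-coefficient : ∀ m k → (G ⊗ G) m k ≡ + convolution c m k
    G²-coefficient m k = begin
      (G ⊗ G) m k
        ≡⟨ ⊗-coefficient G G m k ⟩
      ℤ∑.∑ (suc m) (λ i → ℤ∑.∑ (suc k) (λ j → G i j * G (m ∸ i) (k ∸ j)))
        ≡⟨ ℤ∑.∑-cong (suc m) _ _ (λ i _ → ℤ∑.∑-cong (suc k) _ _ (λ j _ →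
             trans (cong₂ _*_ (G≡ i j) (G≡ (m ∸ i) (k ∸ j))) (sym (ℤₚ.pos-* (c i j) (c (m ∸ i) (k ∸ j)))))) ⟩
      ℤ∑.∑ (suc m) (λ i → ℤ∑.∑ (suc k) (λ j → + (c i j ℕ.* c (m ∸ i) (k ∸ j))))
        ≡⟨ sym (trans (pos-∑ (suc m) row) (ℤ∑.∑-cong (suc m) (λ i → + row i) _ (λ i _ → pos-∑ (suc k) (term i)))) ⟩
      + convolution c m k ∎
      where
      open ≡-Reasoning
      term : ℕ → ℕ → ℕ
      term i j = c i j ℕ.* c (m ∸ i) (k ∸ j)
      row : ℕ → ℕ
      row i = ∑ (suc k) (term i)

    expand : ∀ n k {α β₀ β₁ β₂ β₃} →
      (aS ⊗ (G ⊗ G)) n k ≡ α → (mono -1ℤ 0 0 ⊗ G) n k ≡ β₀ → (mono 1ℤ 1 0 ⊗ G) n k ≡ β₁ →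
      (mono 1ℤ 2 0 ⊗ G) n k ≡ β₂ → (mono -1ℤ 2 1 ⊗ G) n k ≡ β₃ →
      (((aS ⊗ (G ⊗ G)) ⊕ (bS ⊗ G)) ⊕ oneS) n k ≡ α + (β₀ + (β₁ + (β₂ + β₃))) + oneS n k
    expand n k {α} {β₀} {β₁} {β₂} {β₃} eα e₀ e₁ e₂ e₃ = cong (λ u → u + oneS n k) (cong₂ _+_ eα (begin
      (bS ⊗ G) n k                                  ≡⟨ ⊕-⊗ m₀ (m₁ ⊕ (m₂ ⊕ m₃)) G n k ⟩
      P m₀ + ((m₁ ⊕ (m₂ ⊕ m₃)) ⊗ G) n k            ≡⟨ cong (_+_ (P m₀)) (⊕-⊗ m₁ (m₂ ⊕ m₃) G n k) ⟩
      P m₀ + (P m₁ + ((m₂ ⊕ m₃) ⊗ G) n k)          ≡⟨ cong (λ u → P m₀ + (P m₁ + u)) (⊕-⊗ m₂ m₃ G n k) ⟩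
      P m₀ + (P m₁ + (P m₂ + P m₃))                 ≡⟨ cong₂ _+_ e₀ (cong₂ _+_ e₁ (cong₂ _+_ e₂ e₃)) ⟩
      β₀ + (β₁ + (β₂ + β₃))                         ∎))
      where
      open ≡-Reasoning
      m₀ m₁ m₂ m₃ : Series
      m₀ = mono -1ℤ 0 0
      m₁ = mono 1ℤ 1 0
      m₂ = mono 1ℤ 2 0
      m₃ = mono -1ℤ 2 1
      P : Series → ℤ
      P m = (m ⊗ G) n k

    open +-*-Solver

    G≡δ : ∀ n → (∀ k → c n k ≡ δ 0 k) → ∀ k → G n k ≡ + δ 0 k
    G≡δ n c-n k = trans (G≡ n k) (cong +_ (c-n k))

    -- n = 0: only -G and 1 contribute, and c(0, k) = [k = 0].
    solves-0 : ∀ k → (((aS ⊗ (G ⊗ G)) ⊕ (bS ⊗ G)) ⊕ oneS) 0 k ≡ 0ℤ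
    solves-0 k = begin
      _ ≡⟨ expand 0 k (mono-⊗-zero 1ℤ 2 1 (G ⊗ G) 0 k (inj₁ (s≤s z≤n))) (mono-⊗ -1ℤ 0 0 G 0 k z≤n z≤n)
                      (mono-⊗-zero 1ℤ 1 0 G 0 k (inj₁ (s≤s z≤n))) (mono-⊗-zero 1ℤ 2 0 G 0 k (inj₁ (s≤s z≤n)))
                      (mono-⊗-zero -1ℤ 2 1 G 0 k (inj₁ (s≤s z≤n))) ⟩
      0ℤ + (-1ℤ * G 0 k + (0ℤ + (0ℤ + 0ℤ))) + oneS 0 k   ≡⟨ cong (λ u → 0ℤ + (-1ℤ * u + (0ℤ + (0ℤ + 0ℤ))) + oneS 0 k) (G≡δ 0 c-0 k) ⟩
      0ℤ + (-1ℤ * + δ 0 k + (0ℤ + (0ℤ + 0ℤ))) + oneS 0 k ≡⟨ by-k k ⟩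
      0ℤ ∎
      where
      open ≡-Reasoning
      by-k : ∀ k → 0ℤ + (-1ℤ * + δ 0 k + (0ℤ + (0ℤ + 0ℤ))) + oneS 0 k ≡ 0ℤ
      by-k zero    = refl
      by-k (suc k) = refl

    -- n = 1: -G + xG, and c(1, k) = c(0, k).
    solves-1 : ∀ k → (((aS ⊗ (G ⊗ G)) ⊕ (bS ⊗ G)) ⊕ oneS) 1 k ≡ 0ℤ
    solves-1 k = begin
      _ ≡⟨ expand 1 k (mono-⊗-zero 1ℤ 2 1 (G ⊗ G) 1 k (inj₁ (s≤s (s≤s z≤n)))) (mono-⊗ -1ℤ 0 0 G 1 k z≤n z≤n)
                      (mono-⊗ 1ℤ 1 0 G 1 k (s≤s z≤n) z≤n) (mono-⊗-zero 1ℤ 2 0 G 1 k (inj₁ (s≤s (s≤s z≤n))))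
                      (mono-⊗-zero -1ℤ 2 1 G 1 k (inj₁ (s≤s (s≤s z≤n)))) ⟩
      0ℤ + (-1ℤ * G 1 k + (1ℤ * G 0 k + (0ℤ + 0ℤ))) + 0ℤ
        ≡⟨ cong₂ (λ u v → 0ℤ + (-1ℤ * u + (1ℤ * v + (0ℤ + 0ℤ))) + 0ℤ) (G≡δ 1 c-1 k) (G≡δ 0 c-0 k) ⟩
      0ℤ + (-1ℤ * + δ 0 k + (1ℤ * + δ 0 k + (0ℤ + 0ℤ))) + 0ℤ
        ≡⟨ solve 1 (λ d → con 0ℤ :+ (con -1ℤ :* d :+ (con 1ℤ :* d :+ (con 0ℤ :+ con 0ℤ))) :+ con 0ℤ := con 0ℤ) refl (+ δ 0 k) ⟩
      0ℤ ∎
      where open ≡-Reasoning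

    -- n = m+2, k = 0: the t-free part of the recurrence, c(m+2,0) = c(m+1,0) + c(m,0).
    solves-k0 : ∀ m → (((aS ⊗ (G ⊗ G)) ⊕ (bS ⊗ G)) ⊕ oneS) (suc (suc m)) 0 ≡ 0ℤ
    solves-k0 m = begin
      _ ≡⟨ expand n 0 (mono-⊗-zero 1ℤ 2 1 (G ⊗ G) n 0 (inj₂ (s≤s z≤n))) (mono-⊗ -1ℤ 0 0 G n 0 z≤n z≤n)
                      (mono-⊗ 1ℤ 1 0 G n 0 (s≤s z≤n) z≤n) (mono-⊗ 1ℤ 2 0 G n 0 (s≤s (s≤s z≤n)) z≤n)
                      (mono-⊗-zero -1ℤ 2 1 G n 0 (inj₂ (s≤s z≤n))) ⟩
      0ℤ + (-1ℤ * G n 0 + (1ℤ * G (suc m) 0 + (1ℤ * G m 0 + 0ℤ))) + 0ℤ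
        ≡⟨ cong₂ (λ u v → 0ℤ + (-1ℤ * u + v) + 0ℤ) (G≡ n 0) (cong₂ (λ u v → 1ℤ * u + (1ℤ * v + 0ℤ)) (G≡ (suc m) 0) (G≡ m 0)) ⟩
      0ℤ + (-1ℤ * + c n 0 + (1ℤ * + c (suc m) 0 + (1ℤ * + c m 0 + 0ℤ))) + 0ℤ
        ≡⟨ solve 3 (λ x y z → con 0ℤ :+ (con -1ℤ :* x :+ (con 1ℤ :* y :+ (con 1ℤ :* z :+ con 0ℤ))) :+ con 0ℤ := (y :+ z) :- x)
                 refl (+ c n 0) (+ c (suc m) 0) (+ c m 0) ⟩
      (+ c (suc m) 0 + + c m 0) - + c n 0
        ≡⟨ cong (λ u → u - + c n 0) (sym (trans (cong +_ (rec-zero m)) (ℤₚ.pos-+ (c (suc m) 0) (c m 0)))) ⟩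
      + c n 0 - + c n 0
        ≡⟨ ℤₚ.+-inverseʳ (+ c n 0) ⟩
      0ℤ ∎
      where
      open ≡-Reasoning
      n : ℕ
      n = suc (suc m)

    -- n = m+2, k+1: every term contributes, and the recurrence for c(m+2, k+1) closes the sum.
    solves-kS : ∀ m k → (((aS ⊗ (G ⊗ G)) ⊕ (bS ⊗ G)) ⊕ oneS) (suc (suc m)) (suc k) ≡ 0ℤ
    solves-kS m k = begin
      _ ≡⟨ expand n (suc k) (trans (mono-⊗ 1ℤ 2 1 (G ⊗ G) n (suc k) (s≤s (s≤s z≤n)) (s≤s z≤n)) (cong (_*_ 1ℤ) (G²-coefficient m k)))
                            (mono-⊗ -1ℤ 0 0 G n (suc k) z≤n z≤n) (mono-⊗ 1ℤ 1 0 G n (suc k) (s≤s z≤n) z≤n)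
                            (mono-⊗ 1ℤ 2 0 G n (suc k) (s≤s (s≤s z≤n)) z≤n) (mono-⊗ -1ℤ 2 1 G n (suc k) (s≤s (s≤s z≤n)) (s≤s z≤n)) ⟩
      1ℤ * + v + (-1ℤ * G n (suc k) + (1ℤ * G (suc m) (suc k) + (1ℤ * G m (suc k) + -1ℤ * G m k))) + 0ℤ
        ≡⟨ cong₂ (λ u w → 1ℤ * + v + (-1ℤ * u + w) + 0ℤ) (G≡ n (suc k))
             (cong₂ (λ u w → 1ℤ * u + w) (G≡ (suc m) (suc k)) (cong₂ (λ u w → 1ℤ * u + -1ℤ * w) (G≡ m (suc k)) (G≡ m k))) ⟩
      1ℤ * + v + (-1ℤ * + x + (1ℤ * + y + (1ℤ * + z + -1ℤ * + w))) + 0ℤ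
        ≡⟨ solve 5 (λ V X Y Z W → con 1ℤ :* V :+ (con -1ℤ :* X :+ (con 1ℤ :* Y :+ (con 1ℤ :* Z :+ con -1ℤ :* W))) :+ con 0ℤ
                                  := (Y :+ Z :+ V) :- (X :+ W))
                 refl (+ v) (+ x) (+ y) (+ z) (+ w) ⟩
      (+ y + + z + + v) - (+ x + + w)
        ≡⟨ cong (λ u → u - (+ x + + w)) (sym recurrence) ⟩
      (+ x + + w) - (+ x + + w)
        ≡⟨ ℤₚ.+-inverseʳ (+ x + + w) ⟩
      0ℤ ∎
      where
      open ≡-Reasoning
      n : ℕ
      n = suc (suc m)
      v x y z w : ℕ
      v = convolution c m k
      x = c n (suc k)
      y = c (suc m) (suc k)
      z = c m (suc k)
      w = c m k
      recurrence : + x + + w ≡ + y + + z + + v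
      recurrence = begin
        + x + + w          ≡⟨ sym (ℤₚ.pos-+ x w) ⟩
        + (x ℕ.+ w)         ≡⟨ cong +_ (rec-suc m k) ⟩
        + (y ℕ.+ z ℕ.+ v)   ≡⟨ ℤₚ.pos-+ (y ℕ.+ z) v ⟩
        + (y ℕ.+ z) + + v   ≡⟨ cong (_+ + v) (ℤₚ.pos-+ y z) ⟩
        + y + + z + + v     ∎

    solves : ∀ n k → (((aS ⊗ (G ⊗ G)) ⊕ (bS ⊗ G)) ⊕ oneS) n k ≡ 0ℤ
    solves zero                k       = solves-0 k
    solves (suc zero)          k       = solves-1 k
    solves (suc (suc m))       zero    = solves-k0 m
    solves (suc (suc m))       (suc k) = solves-kS m k

  F213-coefficient : ∀ n k → F213 n k ≡ + avCount n k
  F213-coefficient n k = cong +_ (coeff≡avCount n k)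

open Enumeration using (avCount; avCount-0; avCount-1; avCount-rec-zero; avCount-rec-suc)
open SeriesIdentity using (module QuadraticEquation; F213-coefficient)

theorem6p1 : ∀ (n k : ℕ) → (((aS ⊗ (F213 ⊗ F213)) ⊕ (bS ⊗ F213)) ⊕ oneS) n k ≡ zeroS n k
theorem6p1 = QuadraticEquation.solves avCount F213 F213-coefficient avCount-0 avCount-1 avCount-rec-zero avCount-rec-suc
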